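{- Let $A\in\mathbb{F}_2[x]$ be a nonzero square. Then $$\phi(A)=\sum_{\substack{D\mid A\\ A/D\text{ square-free}}}\sigma^*(D).$$
   Context: A divisor $D$ of $A$ is unitary if $\gcd(D,A/D)=1$, and $\sigma^*(A)$ is the sum of all unitary divisors of $A$ in $\mathbb{F}_2[x]$. $\phi$ is the multiplicative function on $\mathbb{F}_2[x]\setminus\{0\}$ (i.e. $\phi(AB)=\phi(A)\phi(B)$ when $\gcd(A,B)=1$, $\phi(1)=1$) defined by $\phi(P^r)=P^r+P^{r-1}$ for $P$ irreducible and $r\ge1$. Sums over $D\mid A$ run over all divisors of $A$ in $\mathbb{F}_2[x]$. -}

module Defs where

open import Data.Bool using (Bool; true; false; not; _∧_; _xor_; if_then_else_)
open import Data.Nat using (ℕ; zero; suc; _⊔_; _≤ᵇ_)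
open import Data.List using (List; []; _∷_; concatMap; map; foldr; filterᵇ; cartesianProduct)
open import Data.Bool.ListAction using (any; all)
open import Data.Product using (_×_; _,_; proj₁; proj₂; ∃)
open import Data.Sum using (_⊎_)
open import Relation.Binary.PropositionalEquality using (_≡_; _≢_)

-- A nonzero polynomial is a bit string (lowest coefficient first) whose
-- last (leading) bit is 1:  'one' is the polynomial 1, and  b ∷ p  is
-- b + x·p.  Every polynomial of F₂[x] has exactly one representation,
-- so propositional equality _≡_ is equality of polynomials.

infixr 5 _∷_

data Pos : Set where
  one : Pos
  _∷_ : Bool → Pos → Pos

data Poly : Set where
  𝟎   : Poly
  pos : Pos → Poly

𝟏 : Poly
𝟏 = pos one

cons : Bool → Poly → Poly
cons false 𝟎       = 𝟎
cons true  𝟎       = pos one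
cons b     (pos p) = pos (b ∷ p)

addPos : Pos → Pos → Poly
addPos one     one     = 𝟎
addPos one     (b ∷ q) = pos (not b ∷ q)
addPos (b ∷ p) one     = pos (not b ∷ p)
addPos (b ∷ p) (c ∷ q) = cons (b xor c) (addPos p q)

infixl 6 _+ₚ_
infixl 7 _*ₚ_
infixr 8 _^ₚ_

_+ₚ_ : Poly → Poly → Poly
𝟎     +ₚ q     = q
pos p +ₚ 𝟎     = pos p
pos p +ₚ pos q = addPos p q

mulPos : Pos → Poly → Poly
mulPos one     q = q
mulPos (b ∷ p) q = (if b then q else 𝟎) +ₚ cons false (mulPos p q)

_*ₚ_ : Poly → Poly → Poly
𝟎     *ₚ q = 𝟎
pos p *ₚ q = mulPos p q

_^ₚ_ : Poly → ℕ → Poly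
P ^ₚ zero  = 𝟏
P ^ₚ suc r = P *ₚ P ^ₚ r

eqPos : Pos → Pos → Bool
eqPos one     one     = true
eqPos one     (_ ∷ _) = false
eqPos (_ ∷ _) one     = false
eqPos (true  ∷ p) (true  ∷ q) = eqPos p q
eqPos (false ∷ p) (false ∷ q) = eqPos p q
eqPos (true  ∷ _) (false ∷ _) = false
eqPos (false ∷ _) (true  ∷ _) = false

_==_ : Poly → Poly → Bool
𝟎     == 𝟎     = true
𝟎     == pos _ = false
pos _ == 𝟎     = false
pos p == pos q = eqPos p q

-- number of coefficients = degree + 1 (and 0 for the zero polynomial)
sizePos : Pos → ℕ
sizePos one     = 1
sizePos (_ ∷ p) = suc (sizePos p)

size : Poly → ℕ
size 𝟎       = 0
size (pos p) = sizePos p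

-- all polynomials with size ≤ n (i.e. degree < n, or zero), each exactly once
allPolys : ℕ → List Poly
allPolys zero    = 𝟎 ∷ []
allPolys (suc n) = concatMap (λ p → cons false p ∷ cons true p ∷ []) (allPolys n)

isZero : Poly → Bool
isZero 𝟎       = true
isZero (pos _) = false

_⇒ᵇ_ : Bool → Bool → Bool
a ⇒ᵇ b = if a then b else true

_∣_ : Poly → Poly → Set
C ∣ A = ∃ λ Q → Q *ₚ C ≡ A

-- gcd(A,B) = 1 (the only unit of F₂[x] is 1)
Coprime : Poly → Poly → Set
Coprime A B = ∀ C → C ∣ A → C ∣ B → C ≡ 𝟏

Irreducible : Poly → Set
Irreducible P = P ≢ 𝟎 × P ≢ 𝟏 × (∀ D E → D *ₚ E ≡ P → D ≡ 𝟏 ⊎ E ≡ 𝟏)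

IsSquare : Poly → Set
IsSquare A = ∃ λ B → A ≡ B *ₚ B

-- C ∣ A : some Q with Q·C = A; if A ≠ 0 such Q has size ≤ size A,
-- and if A = 0 then Q = 0 (in allPolys 0) works.
divides? : Poly → Poly → Bool
divides? C A = any (λ Q → (Q *ₚ C) == A) (allPolys (size A))

-- common divisors of D, E have size ≤ max (size D) (size E) unless D = E = 0
-- (in which case 0 is listed and 0 ≠ 1, correctly giving "not coprime").
coprime? : Poly → Poly → Bool
coprime? D E =
  all (λ C → (divides? C D ∧ divides? C E) ⇒ᵇ (C == 𝟏)) (allPolys (size D ⊔ size E))

squarefree? : Poly → Bool
squarefree? E =
  not (isZero E) ∧ all (λ P → (2 ≤ᵇ size P) ⇒ᵇ not (divides? (P *ₚ P) E)) (allPolys (size E))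

-- all pairs (D , E) with D·E = A; for A ≠ 0 this lists each divisor D of A
-- exactly once, paired with its cofactor E = A/D.
factorPairs : Poly → List (Poly × Poly)
factorPairs A =
  filterᵇ (λ de → (proj₁ de *ₚ proj₂ de) == A)
          (cartesianProduct (allPolys (size A)) (allPolys (size A)))

sumP : List Poly → Poly
sumP = foldr _+ₚ_ 𝟎

σ* : Poly → Poly
σ* A = sumP (map proj₁ (filterᵇ (λ de → coprime? (proj₁ de) (proj₂ de)) (factorPairs A)))

sqfreeSum : Poly → Poly
sqfreeSum A = sumP (map (λ de → σ* (proj₁ de)) (filterᵇ (λ de → squarefree? (proj₂ de)) (factorPairs A)))

module Submission where

-- Both sides are multiplicative in A.  On the right this holds because the summand is
-- a multiplicative function of the factorisation A = D·E: σ* is multiplicative (unitary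
-- divisors of a coprime product are the products of unitary divisors), for coprime E₁, E₂
-- the product E₁E₂ is square-free iff both factors are, and for coprime A, B the
-- factorisations of A·B are exactly the products of factorisations of A and of B.
-- A nonzero square is a product of pairwise coprime P^(2k+2) with P irreducible, so it
-- suffices to compare the two sides there: the square-free divisors of P^(2k+2) are 1
-- and P, and σ*(P^m) = P^m + 1, so in characteristic 2 the sum is
-- (P^(2k+2) + 1) + (P^(2k+1) + 1) = P^(2k+2) + P^(2k+1) = φ(P^(2k+2)).

open import Defs
open import Algebra.Bundles using (CommutativeMonoid)
open import Algebra.Structures using (IsCommutativeMonoid)
import Algebra.Properties.CommutativeSemigroup as CommSemigroupProperties
open import Data.Bool using (Bool; true; false; not; _∧_; _xor_; if_then_else_; T)
open import Data.Bool.Properties using (T-∧; xor-comm; xor-assoc; xor-same; xor-identityʳ; ∧-identityʳ; ∧-comm)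
open import Data.Nat using (ℕ; zero; suc; _+_; _≤_; _<_; _⊔_; _∸_; _≤ᵇ_; z≤n; s≤s)
import Data.Nat.Properties as ℕ
open import Data.Product using (_×_; _,_; proj₁; proj₂; ∃; ∃₂)
open import Data.Sum using (_⊎_; inj₁; inj₂; [_,_]′)
open import Data.Empty using (⊥-elim)
open import Relation.Nullary using (¬_; Dec; yes; no; map′)
open import Relation.Nullary.Decidable using (T?; _×-dec_)
open import Relation.Binary.PropositionalEquality
open import Relation.Binary.PropositionalEquality.Algebra using (isMagma)
open import Function using (_∘_; id; case_of_; Equivalence; mk⇔)
open import Induction.WellFounded using (Acc; acc)
open import Data.Nat.Induction using (<-wellFounded)
open import Data.List using (List; []; _∷_; _++_; map; upTo; concatMap; cartesianProduct; cartesianProductWith; filterᵇ)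
open import Data.List.Properties using (map-∘; map-applyUpTo; map-upTo; upTo-∷ʳ)
open import Data.List.Relation.Binary.Permutation.Propositional using (_↭_; ↭⇒↭ₛ)
open import Data.List.Relation.Binary.Permutation.Propositional.Properties using (map⁺)
open import Data.List.Relation.Binary.Permutation.Setoid.Properties using (foldr-commMonoid)
open import Data.List.Relation.Binary.BagAndSetEquality using (∼bag⇒↭)
open import Data.List.Membership.Propositional.Properties.WithK using (unique∧set⇒bag)
open import Data.List.Membership.Propositional using (_∈_; lose; find)
open import Data.List.Membership.Propositional.Properties
  using ( ∈-applyUpTo⁺; ∈-applyUpTo⁻; ∈-cartesianProductWith⁺; ∈-cartesianProduct⁺; ∈-cartesianProduct⁻
        ; ∈-filter⁺; ∈-filter⁻; ∈-map⁺; ∈-map⁻)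
open import Data.List.Relation.Unary.Any using (here; there; satisfied; any?)
open import Data.List.Relation.Unary.Any.Properties using (any⁺; any⁻)
open import Data.List.Relation.Unary.AllPairs using ([]; _∷_)
open import Data.List.Relation.Unary.All using ([]; _∷_; lookup; tabulate)
open import Data.List.Relation.Unary.All.Properties using (all⁺; all⁻) renaming (map⁺ to All-map⁺)
open import Data.List.Relation.Unary.Unique.Propositional using (Unique)
import Data.List.Relation.Unary.Unique.Propositional.Properties as Unique
open ≡-Reasoning

-- Ring structure of F₂[x]

coeff₀ : Poly → Bool
coeff₀ 𝟎             = false
coeff₀ (pos one)     = true
coeff₀ (pos (b ∷ _)) = b

divX : Poly → Poly
divX 𝟎             = 𝟎
divX (pos one)     = 𝟎
divX (pos (_ ∷ p)) = pos p

coeff₀-cons : ∀ b P → coeff₀ (cons b P) ≡ b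
coeff₀-cons false 𝟎       = refl
coeff₀-cons true  𝟎       = refl
coeff₀-cons false (pos p) = refl
coeff₀-cons true  (pos p) = refl

divX-cons : ∀ b P → divX (cons b P) ≡ P
divX-cons false 𝟎       = refl
divX-cons true  𝟎       = refl
divX-cons false (pos p) = refl
divX-cons true  (pos p) = refl

cons-coeff₀-divX : ∀ P → cons (coeff₀ P) (divX P) ≡ P
cons-coeff₀-divX 𝟎                 = refl
cons-coeff₀-divX (pos one)         = refl
cons-coeff₀-divX (pos (false ∷ p)) = refl
cons-coeff₀-divX (pos (true ∷ p))  = refl

cons-injective : ∀ {b c P Q} → cons b P ≡ cons c Q → b ≡ c × P ≡ Q
cons-injective {b} {c} {P} {Q} eq =
  trans (sym (coeff₀-cons b P)) (trans (cong coeff₀ eq) (coeff₀-cons c Q)) ,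
  trans (sym (divX-cons b P)) (trans (cong divX eq) (divX-cons c Q))

cons-view : (Pr : Poly → Set) → (∀ b P → Pr (cons b P)) → ∀ P → Pr P
cons-view Pr f P = subst Pr (cons-coeff₀-divX P) (f (coeff₀ P) (divX P))

Poly-ind : (Pr : Poly → Set) → Pr 𝟎 → (∀ b P → Pr P → Pr (cons b P)) → ∀ P → Pr P
Poly-ind Pr base step 𝟎                 = base
Poly-ind Pr base step (pos one)         = step true 𝟎 base
Poly-ind Pr base step (pos (false ∷ p)) = step false (pos p) (Poly-ind Pr base step (pos p))
Poly-ind Pr base step (pos (true ∷ p))  = step true (pos p) (Poly-ind Pr base step (pos p))

+-identityˡ : ∀ P → 𝟎 +ₚ P ≡ P
+-identityˡ P = refl

+-identityʳ : ∀ P → P +ₚ 𝟎 ≡ P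
+-identityʳ 𝟎       = refl
+-identityʳ (pos p) = refl

cons-+ : ∀ b c P Q → cons b P +ₚ cons c Q ≡ cons (b xor c) (P +ₚ Q)
cons-+ false c     𝟎       Q       = refl
cons-+ true  false 𝟎       𝟎       = refl
cons-+ true  true  𝟎       𝟎       = refl
cons-+ true  false 𝟎       (pos q) = refl
cons-+ true  true  𝟎       (pos q) = refl
cons-+ false false (pos p) 𝟎       = refl
cons-+ false true  (pos p) 𝟎       = refl
cons-+ true  false (pos p) 𝟎       = refl
cons-+ true  true  (pos p) 𝟎       = refl
cons-+ false false (pos p) (pos q) = refl
cons-+ false true  (pos p) (pos q) = refl
cons-+ true  false (pos p) (pos q) = refl
cons-+ true  true  (pos p) (pos q) = refl

+-comm : ∀ P Q → P +ₚ Q ≡ Q +ₚ P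
+-comm = Poly-ind (λ P → ∀ Q → P +ₚ Q ≡ Q +ₚ P) (λ Q → sym (+-identityʳ Q))
  λ b P ih → cons-view _ λ c Q → begin
    cons b P +ₚ cons c Q     ≡⟨ cons-+ b c P Q ⟩
    cons (b xor c) (P +ₚ Q)  ≡⟨ cong₂ cons (xor-comm b c) (ih Q) ⟩
    cons (c xor b) (Q +ₚ P)  ≡⟨ cons-+ c b Q P ⟨
    cons c Q +ₚ cons b P     ∎

+-assoc : ∀ P Q R → (P +ₚ Q) +ₚ R ≡ P +ₚ (Q +ₚ R)
+-assoc = Poly-ind (λ P → ∀ Q R → (P +ₚ Q) +ₚ R ≡ P +ₚ (Q +ₚ R)) (λ Q R → refl)
  λ b P ih → cons-view _ λ c Q → cons-view _ λ d R → begin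
    (cons b P +ₚ cons c Q) +ₚ cons d R       ≡⟨ cong (_+ₚ cons d R) (cons-+ b c P Q) ⟩
    cons (b xor c) (P +ₚ Q) +ₚ cons d R      ≡⟨ cons-+ (b xor c) d (P +ₚ Q) R ⟩
    cons ((b xor c) xor d) ((P +ₚ Q) +ₚ R)   ≡⟨ cong₂ cons (xor-assoc b c d) (ih Q R) ⟩
    cons (b xor (c xor d)) (P +ₚ (Q +ₚ R))   ≡⟨ cons-+ b (c xor d) P (Q +ₚ R) ⟨
    cons b P +ₚ cons (c xor d) (Q +ₚ R)      ≡⟨ cong (cons b P +ₚ_) (cons-+ c d Q R) ⟨
    cons b P +ₚ (cons c Q +ₚ cons d R)       ∎

x+x≡𝟎 : ∀ P → P +ₚ P ≡ 𝟎
x+x≡𝟎 = Poly-ind (λ P → P +ₚ P ≡ 𝟎) refl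
  λ b P ih → trans (cons-+ b b P P) (cong₂ cons (xor-same b) ih)

+-isCommutativeMonoid : IsCommutativeMonoid _≡_ _+ₚ_ 𝟎
+-isCommutativeMonoid = record
  { isMonoid = record
    { isSemigroup = record { isMagma = isMagma _+ₚ_ ; assoc = +-assoc }
    ; identity    = +-identityˡ , +-identityʳ
    }
  ; comm = +-comm
  }

+-commutativeMonoid : CommutativeMonoid _ _
+-commutativeMonoid = record { isCommutativeMonoid = +-isCommutativeMonoid }

module +-Properties = CommSemigroupProperties (CommutativeMonoid.commutativeSemigroup +-commutativeMonoid)

-- Multiplication by a coefficient, written as in mulPos so that it unfolds definitionally.

infixr 8 _⋆_

_⋆_ : Bool → Poly → Poly
b ⋆ Q = if b then Q else 𝟎

⋆-zero : ∀ b → b ⋆ 𝟎 ≡ 𝟎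
⋆-zero false = refl
⋆-zero true  = refl

⋆-xor : ∀ b c R → (b xor c) ⋆ R ≡ b ⋆ R +ₚ c ⋆ R
⋆-xor false c     R = refl
⋆-xor true  false R = sym (+-identityʳ R)
⋆-xor true  true  R = sym (x+x≡𝟎 R)

⋆-cons : ∀ b c Q → b ⋆ cons c Q ≡ cons (b ∧ c) (b ⋆ Q)
⋆-cons false false Q = refl
⋆-cons false true  Q = refl
⋆-cons true  c     Q = refl

⋆-* : ∀ b X Y → b ⋆ X *ₚ Y ≡ b ⋆ (X *ₚ Y)
⋆-* false X Y = refl
⋆-* true  X Y = refl

cons-* : ∀ b P Q → cons b P *ₚ Q ≡ b ⋆ Q +ₚ cons false (P *ₚ Q)
cons-* false 𝟎       Q = refl
cons-* true  𝟎       Q = sym (+-identityʳ Q)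
cons-* false (pos p) Q = refl
cons-* true  (pos p) Q = refl

*-zeroʳ : ∀ P → P *ₚ 𝟎 ≡ 𝟎
*-zeroʳ = Poly-ind (λ P → P *ₚ 𝟎 ≡ 𝟎) refl
  λ b P ih → trans (cons-* b P 𝟎) (cong₂ (λ u v → u +ₚ cons false v) (⋆-zero b) ih)

*-identityˡ : ∀ P → 𝟏 *ₚ P ≡ P
*-identityˡ P = refl

*-identityʳ : ∀ P → P *ₚ 𝟏 ≡ P
*-identityʳ = Poly-ind (λ P → P *ₚ 𝟏 ≡ P) refl
  λ b P ih → begin
    cons b P *ₚ 𝟏                            ≡⟨ cons-* b P 𝟏 ⟩
    b ⋆ cons true 𝟎 +ₚ cons false (P *ₚ 𝟏)    ≡⟨ cong₂ (λ u v → u +ₚ cons false v) (⋆-cons b true 𝟎) ih ⟩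
    cons (b ∧ true) (b ⋆ 𝟎) +ₚ cons false P   ≡⟨ cons-+ (b ∧ true) false (b ⋆ 𝟎) P ⟩
    cons ((b ∧ true) xor false) (b ⋆ 𝟎 +ₚ P)  ≡⟨ cong₂ cons (trans (xor-identityʳ _) (∧-identityʳ b))
                                                          (cong (_+ₚ P) (⋆-zero b)) ⟩
    cons b P                                 ∎

*-distribʳ-+ : ∀ P Q R → (P +ₚ Q) *ₚ R ≡ P *ₚ R +ₚ Q *ₚ R
*-distribʳ-+ = Poly-ind (λ P → ∀ Q R → (P +ₚ Q) *ₚ R ≡ P *ₚ R +ₚ Q *ₚ R) (λ Q R → refl)
  λ b P ih → cons-view _ λ c Q R → begin
    (cons b P +ₚ cons c Q) *ₚ R
      ≡⟨ cong (_*ₚ R) (cons-+ b c P Q) ⟩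
    cons (b xor c) (P +ₚ Q) *ₚ R
      ≡⟨ cons-* (b xor c) (P +ₚ Q) R ⟩
    (b xor c) ⋆ R +ₚ cons false ((P +ₚ Q) *ₚ R)
      ≡⟨ cong₂ (λ u v → u +ₚ cons false v) (⋆-xor b c R) (ih Q R) ⟩
    (b ⋆ R +ₚ c ⋆ R) +ₚ cons false (P *ₚ R +ₚ Q *ₚ R)
      ≡⟨ cong ((b ⋆ R +ₚ c ⋆ R) +ₚ_) (cons-+ false false (P *ₚ R) (Q *ₚ R)) ⟨
    (b ⋆ R +ₚ c ⋆ R) +ₚ (cons false (P *ₚ R) +ₚ cons false (Q *ₚ R))
      ≡⟨ +-Properties.interchange (b ⋆ R) (c ⋆ R) _ _ ⟩
    (b ⋆ R +ₚ cons false (P *ₚ R)) +ₚ (c ⋆ R +ₚ cons false (Q *ₚ R))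
      ≡⟨ cong₂ _+ₚ_ (cons-* b P R) (cons-* c Q R) ⟨
    cons b P *ₚ R +ₚ cons c Q *ₚ R
      ∎

*-cons : ∀ c P Q → P *ₚ cons c Q ≡ c ⋆ P +ₚ cons false (P *ₚ Q)
*-cons c = Poly-ind (λ P → ∀ Q → P *ₚ cons c Q ≡ c ⋆ P +ₚ cons false (P *ₚ Q))
  (λ Q → sym (cong (_+ₚ 𝟎) (⋆-zero c)))
  λ b P ih Q → begin
    cons b P *ₚ cons c Q
      ≡⟨ cons-* b P (cons c Q) ⟩
    b ⋆ cons c Q +ₚ cons false (P *ₚ cons c Q)
      ≡⟨ cong₂ (λ u v → u +ₚ cons false v) (⋆-cons b c Q) (ih Q) ⟩
    cons (b ∧ c) (b ⋆ Q) +ₚ cons false (c ⋆ P +ₚ cons false (P *ₚ Q))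
      ≡⟨ cons-+ (b ∧ c) false _ _ ⟩
    cons ((b ∧ c) xor false) (b ⋆ Q +ₚ (c ⋆ P +ₚ cons false (P *ₚ Q)))
      ≡⟨ cong₂ cons (cong (_xor false) (∧-comm b c)) (+-Properties.x∙yz≈y∙xz (b ⋆ Q) (c ⋆ P) _) ⟩
    cons ((c ∧ b) xor false) (c ⋆ P +ₚ (b ⋆ Q +ₚ cons false (P *ₚ Q)))
      ≡⟨ cons-+ (c ∧ b) false _ _ ⟨
    cons (c ∧ b) (c ⋆ P) +ₚ cons false (b ⋆ Q +ₚ cons false (P *ₚ Q))
      ≡⟨ cong₂ (λ u v → u +ₚ cons false v) (⋆-cons c b P) (cons-* b P Q) ⟨
    c ⋆ cons b P +ₚ cons false (cons b P *ₚ Q)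
      ∎

*-comm : ∀ P Q → P *ₚ Q ≡ Q *ₚ P
*-comm = Poly-ind (λ P → ∀ Q → P *ₚ Q ≡ Q *ₚ P) (λ Q → sym (*-zeroʳ Q))
  λ b P ih Q → begin
    cons b P *ₚ Q                      ≡⟨ cons-* b P Q ⟩
    b ⋆ Q +ₚ cons false (P *ₚ Q)       ≡⟨ cong (λ z → b ⋆ Q +ₚ cons false z) (ih Q) ⟩
    b ⋆ Q +ₚ cons false (Q *ₚ P)       ≡⟨ *-cons b Q P ⟨
    Q *ₚ cons b P                      ∎

*-assoc : ∀ P Q R → (P *ₚ Q) *ₚ R ≡ P *ₚ (Q *ₚ R)
*-assoc = Poly-ind (λ P → ∀ Q R → (P *ₚ Q) *ₚ R ≡ P *ₚ (Q *ₚ R)) (λ Q R → refl)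
  λ b P ih Q R → begin
    (cons b P *ₚ Q) *ₚ R                            ≡⟨ cong (_*ₚ R) (cons-* b P Q) ⟩
    (b ⋆ Q +ₚ cons false (P *ₚ Q)) *ₚ R             ≡⟨ *-distribʳ-+ (b ⋆ Q) _ R ⟩
    b ⋆ Q *ₚ R +ₚ cons false (P *ₚ Q) *ₚ R          ≡⟨ cong₂ _+ₚ_ (⋆-* b Q R) (cons-* false (P *ₚ Q) R) ⟩
    b ⋆ (Q *ₚ R) +ₚ cons false ((P *ₚ Q) *ₚ R)      ≡⟨ cong (λ z → b ⋆ (Q *ₚ R) +ₚ cons false z) (ih Q R) ⟩
    b ⋆ (Q *ₚ R) +ₚ cons false (P *ₚ (Q *ₚ R))      ≡⟨ cons-* b P (Q *ₚ R) ⟨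
    cons b P *ₚ (Q *ₚ R)                            ∎

*-distribˡ-+ : ∀ P Q R → P *ₚ (Q +ₚ R) ≡ P *ₚ Q +ₚ P *ₚ R
*-distribˡ-+ P Q R = trans (*-comm P _) (trans (*-distribʳ-+ Q R P) (cong₂ _+ₚ_ (*-comm Q P) (*-comm R P)))

*-isCommutativeMonoid : IsCommutativeMonoid _≡_ _*ₚ_ 𝟏
*-isCommutativeMonoid = record
  { isMonoid = record
    { isSemigroup = record { isMagma = isMagma _*ₚ_ ; assoc = *-assoc }
    ; identity    = *-identityˡ , *-identityʳ
    }
  ; comm = *-comm
  }

*-commutativeMonoid : CommutativeMonoid _ _
*-commutativeMonoid = record { isCommutativeMonoid = *-isCommutativeMonoid }

module *-Properties = CommSemigroupProperties (CommutativeMonoid.commutativeSemigroup *-commutativeMonoid)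

eqPos-sound : ∀ p q → T (eqPos p q) → p ≡ q
eqPos-sound one         one         _ = refl
eqPos-sound (true ∷ p)  (true ∷ q)  e = cong (true ∷_) (eqPos-sound p q e)
eqPos-sound (false ∷ p) (false ∷ q) e = cong (false ∷_) (eqPos-sound p q e)

eqPos-refl : ∀ p → T (eqPos p p)
eqPos-refl one         = _
eqPos-refl (true ∷ p)  = eqPos-refl p
eqPos-refl (false ∷ p) = eqPos-refl p

==-sound : ∀ X Y → T (X == Y) → X ≡ Y
==-sound 𝟎       𝟎       _ = refl
==-sound (pos p) (pos q) e = cong pos (eqPos-sound p q e)

==-refl : ∀ X → T (X == X)
==-refl 𝟎       = _
==-refl (pos p) = eqPos-refl p

_≟_ : (X Y : Poly) → Dec (X ≡ Y)
X ≟ Y = map′ (==-sound X Y) (λ { refl → ==-refl X }) (T? (X == Y))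

size≡0⇒≡𝟎 : ∀ {X} → size X ≡ 0 → X ≡ 𝟎
size≡0⇒≡𝟎 {𝟎}           _  = refl
size≡0⇒≡𝟎 {pos one}     ()
size≡0⇒≡𝟎 {pos (_ ∷ _)} ()

size≡1⇒≡𝟏 : ∀ {X} → size X ≡ 1 → X ≡ 𝟏
size≡1⇒≡𝟏 {pos one}         _  = refl
size≡1⇒≡𝟏 {pos (_ ∷ one)}   ()
size≡1⇒≡𝟏 {pos (_ ∷ _ ∷ _)} ()

size>0 : ∀ {X} → X ≢ 𝟎 → 0 < size X
size>0 {𝟎}             nz = ⊥-elim (nz refl)
size>0 {pos one}       _  = s≤s z≤n
size>0 {pos (_ ∷ _)}   _  = s≤s z≤n

size>0⇒≢𝟎 : ∀ {X} → 0 < size X → X ≢ 𝟎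
size>0⇒≢𝟎 {pos _} _ ()

size≥2 : ∀ {X} → X ≢ 𝟎 → X ≢ 𝟏 → 2 ≤ size X
size≥2 {X} nz n1 with size X in eq
... | zero        = ⊥-elim (nz (size≡0⇒≡𝟎 eq))
... | suc zero    = ⊥-elim (n1 (size≡1⇒≡𝟏 eq))
... | suc (suc _) = s≤s (s≤s z≤n)

size≥2⇒≢𝟏 : ∀ {X} → 2 ≤ size X → X ≢ 𝟏
size≥2⇒≢𝟏 (s≤s ()) refl

size≥2⇒≢𝟎 : ∀ {X} → 2 ≤ size X → X ≢ 𝟎
size≥2⇒≢𝟎 le = size>0⇒≢𝟎 (ℕ.≤-trans (s≤s z≤n) le)

size-cons : ∀ b {P} → P ≢ 𝟎 → size (cons b P) ≡ suc (size P)
size-cons false {𝟎}     nz = ⊥-elim (nz refl)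
size-cons true  {𝟎}     nz = ⊥-elim (nz refl)
size-cons false {pos p} _  = refl
size-cons true  {pos p} _  = refl

size-cons-≤ : ∀ b P → size (cons b P) ≤ suc (size P)
size-cons-≤ false 𝟎       = z≤n
size-cons-≤ true  𝟎       = ℕ.≤-refl
size-cons-≤ false (pos p) = ℕ.≤-refl
size-cons-≤ true  (pos p) = ℕ.≤-refl

size-⋆-≤ : ∀ b Q → size (b ⋆ Q) ≤ size Q
size-⋆-≤ false Q = z≤n
size-⋆-≤ true  Q = ℕ.≤-refl

sizePos>0 : ∀ p → 0 < sizePos p
sizePos>0 one     = s≤s z≤n
sizePos>0 (_ ∷ _) = s≤s z≤n

size-addPos-< : ∀ p q → sizePos p < sizePos q → size (addPos p q) ≡ sizePos q
size-addPos-< one     one     (s≤s ())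
size-addPos-< (b ∷ p) one     (s≤s ())
size-addPos-< one     (b ∷ q) _ = refl
size-addPos-< (b ∷ p) (c ∷ q) (s≤s lt) with addPos p q | size-addPos-< p q lt
... | 𝟎     | eq = ⊥-elim (ℕ.<⇒≢ (sizePos>0 q) eq)
... | pos r | eq = trans (size-cons (b xor c) λ ()) (cong suc eq)

size-addPos-≡ : ∀ p q → sizePos p ≡ sizePos q → size (addPos p q) < sizePos q
size-addPos-≡ one     one     _  = s≤s z≤n
size-addPos-≡ one     (b ∷ q) eq = ⊥-elim (ℕ.<⇒≢ (s≤s (sizePos>0 q)) eq)
size-addPos-≡ (b ∷ p) one     eq = ⊥-elim (ℕ.<⇒≢ (s≤s (sizePos>0 p)) (sym eq))
size-addPos-≡ (b ∷ p) (c ∷ q) eq =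
  ℕ.≤-<-trans (size-cons-≤ (b xor c) (addPos p q)) (s≤s (size-addPos-≡ p q (ℕ.suc-injective eq)))

size-+-< : ∀ X Y → size X < size Y → size (X +ₚ Y) ≡ size Y
size-+-< 𝟎       Y       _  = refl
size-+-< (pos p) (pos q) lt = size-addPos-< p q lt

size-+-≡ : ∀ X {Y} → Y ≢ 𝟎 → size X ≡ size Y → size (X +ₚ Y) < size Y
size-+-≡ X       {𝟎}     nz _  = ⊥-elim (nz refl)
size-+-≡ 𝟎       {pos q} _  eq = ⊥-elim (ℕ.<⇒≢ (sizePos>0 q) eq)
size-+-≡ (pos p) {pos q} _  eq = size-addPos-≡ p q eq

*-size : ∀ {X Y} → X ≢ 𝟎 → Y ≢ 𝟎 → X *ₚ Y ≢ 𝟎 × suc (size (X *ₚ Y)) ≡ size X + size Y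
*-size {X} {Y} nX nY = Poly-ind Pr (λ nz → ⊥-elim (nz refl)) step X nX
  where
  Pr : Poly → Set
  Pr X = X ≢ 𝟎 → X *ₚ Y ≢ 𝟎 × suc (size (X *ₚ Y)) ≡ size X + size Y
  constant : ∀ b → Pr (cons b 𝟎)
  constant false nz = ⊥-elim (nz refl)
  constant true  _  = nY , refl
  step : ∀ b P → Pr P → Pr (cons b P)
  step b P ih nz with P ≟ 𝟎
  ... | yes refl = constant b nz
  ... | no nP = product≢𝟎 , (begin
      suc (size (cons b P *ₚ Y))  ≡⟨ cong (suc ∘ size) (cons-* b P Y) ⟩
      suc (size (b ⋆ Y +ₚ XP))    ≡⟨ cong suc sizeBP ⟩
      suc (size XP)               ≡⟨ cong suc sizeXP ⟩
      suc (size P + size Y)       ≡⟨ cong (_+ size Y) (size-cons b nP) ⟨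
      size (cons b P) + size Y    ∎)
    where
    nPY = proj₁ (ih nP)
    XP = cons false (P *ₚ Y)
    sizeXP : size XP ≡ size P + size Y
    sizeXP = trans (size-cons false nPY) (proj₂ (ih nP))
    sizeBP : size (b ⋆ Y +ₚ XP) ≡ size XP
    sizeBP = size-+-< (b ⋆ Y) XP (ℕ.≤-trans (s≤s (size-⋆-≤ b Y))
               (ℕ.≤-trans (ℕ.+-monoˡ-≤ (size Y) (size>0 nP)) (ℕ.≤-reflexive (sym sizeXP))))
    product≢𝟎 : cons b P *ₚ Y ≢ 𝟎
    product≢𝟎 = subst (_≢ 𝟎) (sym (cons-* b P Y))
                  (size>0⇒≢𝟎 (subst (0 <_) (sym (trans sizeBP (size-cons false nPY))) (s≤s z≤n)))

*-≢𝟎 : ∀ {X Y} → X ≢ 𝟎 → Y ≢ 𝟎 → X *ₚ Y ≢ 𝟎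
*-≢𝟎 nX nY = proj₁ (*-size nX nY)

size-* : ∀ {X Y} → X ≢ 𝟎 → Y ≢ 𝟎 → suc (size (X *ₚ Y)) ≡ size X + size Y
size-* nX nY = proj₂ (*-size nX nY)

*-≢𝟎ˡ : ∀ {X Y} → X *ₚ Y ≢ 𝟎 → X ≢ 𝟎
*-≢𝟎ˡ nz refl = nz refl

*-≢𝟎ʳ : ∀ {X Y} → X *ₚ Y ≢ 𝟎 → Y ≢ 𝟎
*-≢𝟎ʳ {X} nz refl = nz (*-zeroʳ X)

x+y≡𝟎⇒x≡y : ∀ X Y → X +ₚ Y ≡ 𝟎 → X ≡ Y
x+y≡𝟎⇒x≡y X Y eq = begin
  X                ≡⟨ +-identityʳ X ⟨
  X +ₚ 𝟎           ≡⟨ cong (X +ₚ_) (x+x≡𝟎 Y) ⟨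
  X +ₚ (Y +ₚ Y)    ≡⟨ +-assoc X Y Y ⟨
  (X +ₚ Y) +ₚ Y    ≡⟨ cong (_+ₚ Y) eq ⟩
  Y                ∎

*-cancelʳ : ∀ {X Y Z} → Z ≢ 𝟎 → X *ₚ Z ≡ Y *ₚ Z → X ≡ Y
*-cancelʳ {X} {Y} {Z} nZ eq with (X +ₚ Y) ≟ 𝟎
... | yes X+Y≡𝟎 = x+y≡𝟎⇒x≡y X Y X+Y≡𝟎
... | no  X+Y≢𝟎 = ⊥-elim (*-≢𝟎 X+Y≢𝟎 nZ (begin
  (X +ₚ Y) *ₚ Z         ≡⟨ *-distribʳ-+ X Y Z ⟩
  X *ₚ Z +ₚ Y *ₚ Z      ≡⟨ cong (_+ₚ Y *ₚ Z) eq ⟩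
  Y *ₚ Z +ₚ Y *ₚ Z      ≡⟨ x+x≡𝟎 (Y *ₚ Z) ⟩
  𝟎                     ∎))

*-cancelˡ : ∀ {X Y Z} → Z ≢ 𝟎 → Z *ₚ X ≡ Z *ₚ Y → X ≡ Y
*-cancelˡ {X} {Y} {Z} nZ eq = *-cancelʳ nZ (trans (*-comm X Z) (trans eq (*-comm Z Y)))

size-*-≥ʳ : ∀ {X Y} → X ≢ 𝟎 → Y ≢ 𝟎 → size Y ≤ size (X *ₚ Y)
size-*-≥ʳ {X} {Y} nX nY =
  ℕ.≤-pred (ℕ.≤-trans (ℕ.+-monoˡ-≤ (size Y) (size>0 nX)) (ℕ.≤-reflexive (sym (size-* nX nY))))

size-*->ˡ : ∀ {X Y} → X ≢ 𝟎 → 2 ≤ size Y → size X < size (X *ₚ Y)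
size-*->ˡ {X} {Y} nX le = ℕ.≤-pred (ℕ.≤-trans (ℕ.≤-reflexive (ℕ.+-comm 2 (size X)))
  (ℕ.≤-trans (ℕ.+-monoʳ-≤ (size X) le) (ℕ.≤-reflexive (sym (size-* nX (size≥2⇒≢𝟎 le))))))

∣-refl : ∀ {A} → A ∣ A
∣-refl = 𝟏 , refl

∣-trans : ∀ {A B C} → A ∣ B → B ∣ C → A ∣ C
∣-trans {A} (q , refl) (r , refl) = r *ₚ q , *-assoc r q A

A∣B*A : ∀ A B → A ∣ (B *ₚ A)
A∣B*A A B = B , refl

A∣A*B : ∀ A B → A ∣ (A *ₚ B)
A∣A*B A B = B , *-comm B A

*≡⇒∣ˡ : ∀ {D E A} → D *ₚ E ≡ A → D ∣ A
*≡⇒∣ˡ {D} {E} refl = A∣A*B D E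

*≡⇒∣ʳ : ∀ {D E A} → D *ₚ E ≡ A → E ∣ A
*≡⇒∣ʳ {D} {E} refl = A∣B*A E D

∣A⇒∣B*A : ∀ {C A} B → C ∣ A → C ∣ (B *ₚ A)
∣A⇒∣B*A {C} B (q , refl) = B *ₚ q , *-assoc B q C

∣A⇒∣A*B : ∀ {C A} B → C ∣ A → C ∣ (A *ₚ B)
∣A⇒∣A*B {C} {A} B d = subst (C ∣_) (*-comm B A) (∣A⇒∣B*A B d)

∣A∣B⇒∣A+B : ∀ {C A B} → C ∣ A → C ∣ B → C ∣ (A +ₚ B)
∣A∣B⇒∣A+B {C} (q , refl) (r , refl) = q +ₚ r , *-distribʳ-+ q r C

*-mono-∣ : ∀ {A B C D} → A ∣ B → C ∣ D → (A *ₚ C) ∣ (B *ₚ D)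
*-mono-∣ {A} {_} {C} (q , refl) (r , refl) = q *ₚ r , *-Properties.interchange q r A C

𝟏∣A : ∀ A → 𝟏 ∣ A
𝟏∣A A = A , *-identityʳ A

A∣𝟎 : ∀ A → A ∣ 𝟎
A∣𝟎 A = 𝟎 , refl

∣≢𝟎⇒≢𝟎 : ∀ {C A} → A ≢ 𝟎 → C ∣ A → C ≢ 𝟎
∣≢𝟎⇒≢𝟎 {C} nA (q , refl) refl = nA (*-zeroʳ q)

∣⇒size≤ : ∀ {C A} → A ≢ 𝟎 → C ∣ A → size C ≤ size A
∣⇒size≤ {C} nA (q , refl) = size-*-≥ʳ (*-≢𝟎ˡ {q} {C} nA) (*-≢𝟎ʳ {q} {C} nA)

∣-antisym : ∀ {C A} → A ≢ 𝟎 → C ∣ A → A ∣ C → C ≡ A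
∣-antisym {C} {A} nA (q , eq) A∣C = begin
  C          ≡⟨ cong (_*ₚ C) (sym q≡𝟏) ⟩
  q *ₚ C     ≡⟨ eq ⟩
  A          ∎
  where
  nA' = subst (_≢ 𝟎) (sym eq) nA
  nq = *-≢𝟎ˡ {q} {C} nA'
  nC = *-≢𝟎ʳ {q} {C} nA'
  sizeC≡sizeA : size C ≡ size A
  sizeC≡sizeA = ℕ.≤-antisym (∣⇒size≤ nA (q , eq)) (∣⇒size≤ nC A∣C)
  q≡𝟏 : q ≡ 𝟏
  q≡𝟏 = size≡1⇒≡𝟏 (ℕ.+-cancelʳ-≡ (size C) (size q) 1
          (trans (sym (size-* nq nC)) (cong suc (trans (cong size eq) (sym sizeC≡sizeA)))))

∣𝟏⇒≡𝟏 : ∀ {C} → C ∣ 𝟏 → C ≡ 𝟏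
∣𝟏⇒≡𝟏 {C} d = ∣-antisym (λ ()) d (𝟏∣A C)

private
  consBit : Poly → Bool → Poly
  consBit P b = cons b P

allPolys-suc : ∀ n → allPolys (suc n) ≡ cartesianProductWith consBit (allPolys n) (false ∷ true ∷ [])
allPolys-suc n = go (allPolys n)
  where
  go : ∀ Ps → concatMap (λ P → cons false P ∷ cons true P ∷ []) Ps ≡
              cartesianProductWith consBit Ps (false ∷ true ∷ [])
  go []       = refl
  go (P ∷ Ps) = cong (λ l → cons false P ∷ cons true P ∷ l) (go Ps)

∈-allPolys : ∀ n {P} → size P ≤ n → P ∈ allPolys n
∈-allPolys zero    {P} le = here (size≡0⇒≡𝟎 (ℕ.n≤0⇒n≡0 le))
∈-allPolys (suc n) {P} le = subst (_∈ allPolys (suc n)) (cons-coeff₀-divX P)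
  (subst (cons (coeff₀ P) (divX P) ∈_) (sym (allPolys-suc n))
    (∈-cartesianProductWith⁺ consBit (∈-allPolys n (ℕ.≤-trans (size-divX P) (ℕ.∸-monoˡ-≤ 1 le)))
                                     (bit∈ (coeff₀ P))))
  where
  size-divX : ∀ P → size (divX P) ≤ size P ∸ 1
  size-divX 𝟎             = z≤n
  size-divX (pos one)     = z≤n
  size-divX (pos (_ ∷ p)) = ℕ.≤-refl
  bit∈ : ∀ b → b ∈ false ∷ true ∷ []
  bit∈ false = here refl
  bit∈ true  = there (here refl)

allPolys-unique : ∀ n → Unique (allPolys n)
allPolys-unique zero    = [] ∷ []
allPolys-unique (suc n) = subst Unique (sym (allPolys-suc n))
  (Unique.cartesianProductWith⁺ consBit (λ eq → let (b≡c , P≡Q) = cons-injective eq in P≡Q , b≡c)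
    (allPolys-unique n) (((λ ()) ∷ []) ∷ [] ∷ []))

divides?-sound : ∀ C A → T (divides? C A) → C ∣ A
divides?-sound C A t with satisfied (any⁻ (λ Q → (Q *ₚ C) == A) (allPolys (size A)) t)
... | Q , e = Q , ==-sound _ _ e

divides?-complete : ∀ C A → C ∣ A → T (divides? C A)
divides?-complete C A (Q , eq) with A ≟ 𝟎
... | yes refl = any⁺ (λ Q → (Q *ₚ C) == 𝟎) (here {x = 𝟎} {xs = []} (==-refl 𝟎))
... | no nA = any⁺ (λ Q → (Q *ₚ C) == A)
                 (lose {x = Q} (∈-allPolys (size A) (∣⇒size≤ nA (C , trans (*-comm C Q) eq)))
                               (subst (λ X → T (X == A)) (sym eq) (==-refl A)))

_∣?_ : ∀ C A → Dec (C ∣ A)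
C ∣? A = map′ (divides?-sound C A) (divides?-complete C A) (T? (divides? C A))

-- Bézout, Gauss and Euclid

Coprime-sym : ∀ {A B} → Coprime A B → Coprime B A
Coprime-sym cp C C∣B C∣A = cp C C∣A C∣B

Coprime-∣ : ∀ {A B A' B'} → Coprime A B → A' ∣ A → B' ∣ B → Coprime A' B'
Coprime-∣ cp A'∣A B'∣B C C∣A' C∣B' = cp C (∣-trans C∣A' A'∣A) (∣-trans C∣B' B'∣B)

Coprime-𝟏 : ∀ A → Coprime 𝟏 A
Coprime-𝟏 A C C∣𝟏 _ = ∣𝟏⇒≡𝟏 C∣𝟏

record Bezout (A B : Poly) : Set where
  constructor mkBezout
  field
    gcd      : Poly
    gcd∣A    : gcd ∣ A
    gcd∣B    : gcd ∣ B
    u v      : Poly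
    identity : u *ₚ A +ₚ v *ₚ B ≡ gcd

Bezout-sym : ∀ {A B} → Bezout A B → Bezout B A
Bezout-sym (mkBezout G G∣A G∣B u v eq) = mkBezout G G∣B G∣A v u (trans (+-comm (v *ₚ _) (u *ₚ _)) eq)

x+[x+y]≡y : ∀ X Y → X +ₚ (X +ₚ Y) ≡ Y
x+[x+y]≡y X Y = trans (sym (+-assoc X X Y)) (cong (_+ₚ Y) (x+x≡𝟎 X))

-- In characteristic 2, A = M·B + (M·B + A): the pairs (A, B) and (M·B + A, B) generate the same ideal.
Bezout-step : ∀ {A B} M → Bezout (M *ₚ B +ₚ A) B → Bezout A B
Bezout-step {A} {B} M (mkBezout G G∣A' G∣B u v eq) =
  mkBezout G G∣A G∣B u (u *ₚ M +ₚ v) (begin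
    u *ₚ A +ₚ (u *ₚ M +ₚ v) *ₚ B          ≡⟨ cong (u *ₚ A +ₚ_) (*-distribʳ-+ (u *ₚ M) v B) ⟩
    u *ₚ A +ₚ ((u *ₚ M) *ₚ B +ₚ v *ₚ B)   ≡⟨ +-assoc (u *ₚ A) _ _ ⟨
    (u *ₚ A +ₚ (u *ₚ M) *ₚ B) +ₚ v *ₚ B   ≡⟨ cong (λ z → (u *ₚ A +ₚ z) +ₚ v *ₚ B) (*-assoc u M B) ⟩
    (u *ₚ A +ₚ u *ₚ (M *ₚ B)) +ₚ v *ₚ B   ≡⟨ cong (_+ₚ v *ₚ B) (+-comm (u *ₚ A) _) ⟩
    (u *ₚ (M *ₚ B) +ₚ u *ₚ A) +ₚ v *ₚ B   ≡⟨ cong (_+ₚ v *ₚ B) (*-distribˡ-+ u (M *ₚ B) A) ⟨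
    u *ₚ (M *ₚ B +ₚ A) +ₚ v *ₚ B          ≡⟨ eq ⟩
    G                                     ∎)
  where G∣A = subst (G ∣_) (x+[x+y]≡y (M *ₚ B) A) (∣A∣B⇒∣A+B (∣A⇒∣B*A M G∣B) G∣A')

x^_ : ℕ → Poly
x^ zero  = 𝟏
x^ suc k = cons false (x^ k)

x^≢𝟎 : ∀ k → x^ k ≢ 𝟎
x^≢𝟎 zero    ()
x^≢𝟎 (suc k) eq = x^≢𝟎 k (proj₂ (cons-injective {false} {false} eq))

size-x^ : ∀ k → size (x^ k) ≡ suc k
size-x^ zero    = refl
size-x^ (suc k) = trans (size-cons false (x^≢𝟎 k)) (cong suc (size-x^ k))

size-leading-cancel : ∀ {A B} → B ≢ 𝟎 → size B ≤ size A → size ((x^ (size A ∸ size B)) *ₚ B +ₚ A) < size A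
size-leading-cancel {A} {B} nB le = size-+-≡ ((x^ k) *ₚ B) nA (ℕ.suc-injective (begin
  suc (size ((x^ k) *ₚ B))  ≡⟨ size-* (x^≢𝟎 k) nB ⟩
  size (x^ k) + size B      ≡⟨ cong (_+ size B) (size-x^ k) ⟩
  suc (k + size B)          ≡⟨ cong suc (ℕ.m∸n+n≡m le) ⟩
  suc (size A)              ∎))
  where
  k = size A ∸ size B
  nA = size>0⇒≢𝟎 (ℕ.≤-trans (size>0 nB) le)

bezout : ∀ A B → Bezout A B
bezout A B = go A B (<-wellFounded (size A + size B))
  where
  go : ∀ A B → Acc _<_ (size A + size B) → Bezout A B
  go A B rec with A ≟ 𝟎 | B ≟ 𝟎
  ... | yes refl | _        = mkBezout B (A∣𝟎 B) ∣-refl 𝟎 𝟏 refl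
  ... | no nA    | yes refl = mkBezout A ∣-refl (A∣𝟎 A) 𝟏 𝟎 (+-identityʳ A)
  go A B (acc rec) | no nA | no nB with ℕ.≤-total (size B) (size A)
  ... | inj₁ B≤A = Bezout-step M (go (M *ₚ B +ₚ A) B (rec (ℕ.+-monoˡ-< (size B) (size-leading-cancel nB B≤A))))
    where M = x^ (size A ∸ size B)
  ... | inj₂ A≤B = Bezout-sym (Bezout-step M (Bezout-sym
                     (go A (M *ₚ A +ₚ B) (rec (ℕ.+-monoʳ-< (size A) (size-leading-cancel nA A≤B))))))
    where M = x^ (size B ∸ size A)

Coprime⇒identity : ∀ {A B} → Coprime A B → ∃₂ λ u v → u *ₚ A +ₚ v *ₚ B ≡ 𝟏
Coprime⇒identity {A} {B} cp with bezout A B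
... | mkBezout G G∣A G∣B u v eq = u , v , trans eq (cp G G∣A G∣B)

coprime-divisor : ∀ {A B C} → Coprime A C → A ∣ (B *ₚ C) → A ∣ B
coprime-divisor {A} {B} {C} cp A∣BC with Coprime⇒identity cp
... | u , v , eq = subst (A ∣_) B≡ (∣A∣B⇒∣A+B (∣A⇒∣B*A (B *ₚ u) ∣-refl) (∣A⇒∣B*A v A∣BC))
  where
  B≡ : (B *ₚ u) *ₚ A +ₚ v *ₚ (B *ₚ C) ≡ B
  B≡ = begin
    (B *ₚ u) *ₚ A +ₚ v *ₚ (B *ₚ C)    ≡⟨ cong₂ _+ₚ_ (*-assoc B u A) (*-Properties.x∙yz≈y∙xz v B C) ⟩
    B *ₚ (u *ₚ A) +ₚ B *ₚ (v *ₚ C)    ≡⟨ *-distribˡ-+ B _ _ ⟨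
    B *ₚ (u *ₚ A +ₚ v *ₚ C)           ≡⟨ cong (B *ₚ_) eq ⟩
    B *ₚ 𝟏                            ≡⟨ *-identityʳ B ⟩
    B                                 ∎

Coprime-*ˡ : ∀ {A B C} → Coprime A C → Coprime B C → Coprime (A *ₚ B) C
Coprime-*ˡ {A} {B} cpA cpB X X∣AB X∣C =
  cpB X (coprime-divisor (Coprime-∣ (Coprime-sym cpA) X∣C ∣-refl) (subst (X ∣_) (*-comm A B) X∣AB)) X∣C

Coprime-*ʳ : ∀ {A B C} → Coprime C A → Coprime C B → Coprime C (A *ₚ B)
Coprime-*ʳ cpA cpB = Coprime-sym (Coprime-*ˡ (Coprime-sym cpA) (Coprime-sym cpB))

Irreducible⇒≢𝟎 : ∀ {P} → Irreducible P → P ≢ 𝟎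
Irreducible⇒≢𝟎 = proj₁

Irreducible⇒≢𝟏 : ∀ {P} → Irreducible P → P ≢ 𝟏
Irreducible⇒≢𝟏 = proj₁ ∘ proj₂

Irreducible⇒size≥2 : ∀ {P} → Irreducible P → 2 ≤ size P
Irreducible⇒size≥2 irr = size≥2 (Irreducible⇒≢𝟎 irr) (Irreducible⇒≢𝟏 irr)

Irreducible-divisor : ∀ {P D} → Irreducible P → D ∣ P → D ≡ 𝟏 ⊎ D ≡ P
Irreducible-divisor (_ , _ , factors) (q , eq) with factors q _ eq
... | inj₁ refl = inj₂ eq
... | inj₂ D≡𝟏  = inj₁ D≡𝟏

∤⇒Coprime : ∀ {P A} → Irreducible P → ¬ (P ∣ A) → Coprime P A
∤⇒Coprime irr P∤A C C∣P C∣A with Irreducible-divisor irr C∣P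
... | inj₁ C≡𝟏 = C≡𝟏
... | inj₂ refl = ⊥-elim (P∤A C∣A)

euclidsLemma : ∀ {P A B} → Irreducible P → P ∣ (A *ₚ B) → P ∣ A ⊎ P ∣ B
euclidsLemma {P} {A} {B} irr P∣AB with P ∣? A
... | yes P∣A = inj₁ P∣A
... | no  P∤A = inj₂ (coprime-divisor (∤⇒Coprime irr P∤A) (subst (P ∣_) (*-comm A B) P∣AB))

-- Either the finite search finds a divisor of intermediate degree, on which we recurse,
-- or there is none and C itself is irreducible.
irreducible-factor : ∀ C → 2 ≤ size C → ∃ λ P → Irreducible P × P ∣ C
irreducible-factor C = go C (<-wellFounded (size C))
  where
  go : ∀ C → Acc _<_ (size C) → 2 ≤ size C → ∃ λ P → Irreducible P × P ∣ C
  go C (acc rec) 2≤C with any? (λ D → 2 ℕ.≤? size D ×-dec size D ℕ.<? size C ×-dec D ∣? C) (allPolys (size C))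
  ... | yes found with find found
  ...   | D , _ , 2≤D , D<C , D∣C with go D (rec D<C) 2≤D
  ...     | P , irr , P∣D = P , irr , ∣-trans P∣D D∣C
  go C _ 2≤C | no none = C , (nC , size≥2⇒≢𝟏 2≤C , factors) , ∣-refl
    where
    nC = size≥2⇒≢𝟎 2≤C
    factors : ∀ D E → D *ₚ E ≡ C → D ≡ 𝟏 ⊎ E ≡ 𝟏
    factors D E eq with D ≟ 𝟏 | E ≟ 𝟏
    ... | yes D≡𝟏 | _       = inj₁ D≡𝟏
    ... | no _    | yes E≡𝟏 = inj₂ E≡𝟏
    ... | no D≢𝟏  | no E≢𝟏  =
      ⊥-elim (none (lose (∈-allPolys (size C) (ℕ.<⇒≤ D<C)) (2≤D , D<C , *≡⇒∣ˡ {D} {E} eq)))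
      where
      nDE = subst (_≢ 𝟎) (sym eq) nC
      nD = *-≢𝟎ˡ {D} {E} nDE
      2≤D = size≥2 nD D≢𝟏
      D<C = subst (λ X → size D < size X) eq (size-*->ˡ nD (size≥2 (*-≢𝟎ʳ {D} {E} nDE) E≢𝟏))

^-≢𝟎 : ∀ {P} → P ≢ 𝟎 → ∀ n → P ^ₚ n ≢ 𝟎
^-≢𝟎 nP zero    ()
^-≢𝟎 nP (suc n) = *-≢𝟎 nP (^-≢𝟎 nP n)

^-distribˡ-+-* : ∀ P i j → P ^ₚ (i + j) ≡ P ^ₚ i *ₚ P ^ₚ j
^-distribˡ-+-* P zero    j = refl
^-distribˡ-+-* P (suc i) j = trans (cong (P *ₚ_) (^-distribˡ-+-* P i j)) (sym (*-assoc P (P ^ₚ i) (P ^ₚ j)))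

^-injective : ∀ {P} → Irreducible P → ∀ i j → P ^ₚ i ≡ P ^ₚ j → i ≡ j
^-injective     irr zero    zero    _  = refl
^-injective {P} irr zero    (suc j) eq =
  ⊥-elim (Irreducible⇒≢𝟏 irr (∣𝟏⇒≡𝟏 (subst (P ∣_) (sym eq) (A∣A*B P (P ^ₚ j)))))
^-injective {P} irr (suc i) zero    eq =
  ⊥-elim (Irreducible⇒≢𝟏 irr (∣𝟏⇒≡𝟏 (subst (P ∣_) eq (A∣A*B P (P ^ₚ i)))))
^-injective     irr (suc i) (suc j) eq = cong suc (^-injective irr i j (*-cancelˡ (Irreducible⇒≢𝟎 irr) eq))

∣^⇒≡^ : ∀ {P} → Irreducible P → ∀ n {D} → D ∣ (P ^ₚ n) → ∃ λ i → i ≤ n × D ≡ P ^ₚ i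
∣^⇒≡^ irr zero D∣𝟏 = 0 , z≤n , ∣𝟏⇒≡𝟏 D∣𝟏
∣^⇒≡^ {P} irr (suc n) {D} (r , eq) with P ∣? D
... | yes (q , refl) with ∣^⇒≡^ irr n {q} (r , *-cancelʳ (Irreducible⇒≢𝟎 irr) (begin
        (r *ₚ q) *ₚ P       ≡⟨ *-assoc r q P ⟩
        r *ₚ (q *ₚ P)       ≡⟨ eq ⟩
        P *ₚ P ^ₚ n         ≡⟨ *-comm P (P ^ₚ n) ⟩
        P ^ₚ n *ₚ P         ∎))
...   | i , i≤n , refl = suc i , s≤s i≤n , *-comm (P ^ₚ i) P
∣^⇒≡^ {P} irr (suc n) {D} (r , eq) | no P∤D with ∣^⇒≡^ irr n {D}
        (coprime-divisor (Coprime-sym (∤⇒Coprime irr P∤D)) (r , trans eq (*-comm P (P ^ₚ n))))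
... | i , i≤n , D≡ = i , ℕ.m≤n⇒m≤1+n i≤n , D≡

¬Coprime-^ : ∀ {P} → Irreducible P → ∀ i j → ¬ Coprime (P ^ₚ suc i) (P ^ₚ suc j)
¬Coprime-^ {P} irr i j cp = Irreducible⇒≢𝟏 irr (cp P (A∣A*B P _) (A∣A*B P _))

∤⇒Coprime-^ : ∀ {P B} → Irreducible P → ¬ (P ∣ B) → ∀ k → Coprime (P ^ₚ k) B
∤⇒Coprime-^ {P} irr P∤B k C C∣Pᵏ C∣B with ∣^⇒≡^ irr k C∣Pᵏ
... | zero  , _ , C≡𝟏  = C≡𝟏
... | suc i , _ , refl = ⊥-elim (P∤B (∣-trans (A∣A*B P (P ^ₚ i)) C∣B))

∣⇒maximal-power : ∀ {P} → Irreducible P → ∀ {S} → S ≢ 𝟎 → P ∣ S →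
                  ∃₂ λ k T → S ≡ P ^ₚ suc k *ₚ T × ¬ (P ∣ T)
∣⇒maximal-power {P} irr {S} nS = go S (<-wellFounded (size S)) nS
  where
  go : ∀ S → Acc _<_ (size S) → S ≢ 𝟎 → P ∣ S → ∃₂ λ k T → S ≡ P ^ₚ suc k *ₚ T × ¬ (P ∣ T)
  go S (acc rec) nS (q , refl) with P ∣? q
  ... | no P∤q = 0 , q , trans (*-comm q P) (cong (_*ₚ q) (sym (*-identityʳ P))) , P∤q
  ... | yes P∣q with go q (rec (size-*->ˡ nq (Irreducible⇒size≥2 irr))) nq P∣q
    where nq = *-≢𝟎ˡ {q} {P} nS
  ...   | k , T , refl , P∤T = suc k , T , (begin
          (P ^ₚ suc k *ₚ T) *ₚ P    ≡⟨ *-comm _ P ⟩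
          P *ₚ (P ^ₚ suc k *ₚ T)    ≡⟨ *-assoc P _ T ⟨
          P ^ₚ suc (suc k) *ₚ T     ∎) , P∤T

coprime-*-∣ : ∀ {D₁ D₂ D} → Coprime D₂ D₁ → D₁ ∣ D → D₂ ∣ D → (D₁ *ₚ D₂) ∣ D
coprime-*-∣ {D₁} {D₂} cp (k , refl) D₂∣kD₁ with coprime-divisor {D₂} {k} {D₁} cp D₂∣kD₁
... | m , refl = m , trans (cong (m *ₚ_) (*-comm D₁ D₂)) (sym (*-assoc m D₂ D₁))

-- D₁ = gcd (D, A) and D₂ = gcd (D, B); their product divides D, and D divides it
-- because it is a combination of D and A·B.
divisor-split : ∀ {A B D} → Coprime A B → A *ₚ B ≢ 𝟎 → D ∣ (A *ₚ B) →
                ∃₂ λ D₁ D₂ → D₁ ∣ A × D₂ ∣ B × D₁ *ₚ D₂ ≡ D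
divisor-split {A} {B} {D} cp nAB D∣AB with bezout D A | bezout D B
... | mkBezout D₁ D₁∣D D₁∣A a b eq₁ | mkBezout D₂ D₂∣D D₂∣B c d eq₂ =
  D₁ , D₂ , D₁∣A , D₂∣B ,
  ∣-antisym (∣≢𝟎⇒≢𝟎 nAB D∣AB) (coprime-*-∣ (Coprime-∣ (Coprime-sym cp) D₂∣B D₁∣A) D₁∣D D₂∣D)
    (subst (D ∣_) (cong₂ _*ₚ_ eq₁ eq₂) D∣product)
  where
  Y = c *ₚ D +ₚ d *ₚ B
  D∣product : D ∣ ((a *ₚ D +ₚ b *ₚ A) *ₚ Y)
  D∣product = subst (D ∣_) (sym (*-distribʳ-+ (a *ₚ D) (b *ₚ A) Y))
    (∣A∣B⇒∣A+B (∣A⇒∣A*B Y (A∣B*A D a))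
      (subst (D ∣_) (sym (*-distribˡ-+ (b *ₚ A) (c *ₚ D) (d *ₚ B)))
        (∣A∣B⇒∣A+B (∣A⇒∣B*A (b *ₚ A) (A∣B*A D c))
          (subst (D ∣_) (*-Properties.interchange b d A B) (∣A⇒∣B*A (b *ₚ d) D∣AB)))))

-- Square-free polynomials

SquareFree : Poly → Set
SquareFree E = E ≢ 𝟎 × (∀ Q → 2 ≤ size Q → ¬ ((Q *ₚ Q) ∣ E))

SquareFree-* : ∀ {E₁ E₂} → Coprime E₁ E₂ → SquareFree E₁ → SquareFree E₂ → SquareFree (E₁ *ₚ E₂)
SquareFree-* {E₁} {E₂} cp (n₁ , sf₁) (n₂ , sf₂) = *-≢𝟎 n₁ n₂ , no-square
  where
  Coprime² : ∀ {P B} → Irreducible P → ¬ (P ∣ B) → Coprime (P *ₚ P) B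
  Coprime² irr P∤B = Coprime-*ˡ (∤⇒Coprime irr P∤B) (∤⇒Coprime irr P∤B)
  no-irreducible-square : ∀ P → Irreducible P → ¬ ((P *ₚ P) ∣ (E₁ *ₚ E₂))
  no-irreducible-square P irr PP∣E with euclidsLemma irr (∣-trans (A∣A*B P P) PP∣E)
  ... | inj₁ P∣E₁ = sf₁ P (Irreducible⇒size≥2 irr) (coprime-divisor (Coprime² irr P∤E₂) PP∣E)
    where P∤E₂ = λ P∣E₂ → Irreducible⇒≢𝟏 irr (cp P P∣E₁ P∣E₂)
  ... | inj₂ P∣E₂ = sf₂ P (Irreducible⇒size≥2 irr)
                      (coprime-divisor (Coprime² irr P∤E₁) (subst ((P *ₚ P) ∣_) (*-comm E₁ E₂) PP∣E))
    where P∤E₁ = λ P∣E₁ → Irreducible⇒≢𝟏 irr (cp P P∣E₁ P∣E₂)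
  no-square : ∀ Q → 2 ≤ size Q → ¬ ((Q *ₚ Q) ∣ (E₁ *ₚ E₂))
  no-square Q 2≤Q QQ∣E with irreducible-factor Q 2≤Q
  ... | P , irr , P∣Q = no-irreducible-square P irr (∣-trans (*-mono-∣ P∣Q P∣Q) QQ∣E)

SquareFree-*⁻ : ∀ {E₁ E₂} → SquareFree (E₁ *ₚ E₂) → SquareFree E₁ × SquareFree E₂
SquareFree-*⁻ {E₁} {E₂} (nz , sf) =
  (*-≢𝟎ˡ {E₁} {E₂} nz , λ Q 2≤Q QQ∣E₁ → sf Q 2≤Q (∣A⇒∣A*B E₂ QQ∣E₁)) ,
  (*-≢𝟎ʳ {E₁} {E₂} nz , λ Q 2≤Q QQ∣E₂ → sf Q 2≤Q (∣A⇒∣B*A E₁ QQ∣E₂))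

SquareFree-^⇒≤1 : ∀ {P} → Irreducible P → ∀ j → SquareFree (P ^ₚ j) → j ≤ 1
SquareFree-^⇒≤1 irr zero          _        = z≤n
SquareFree-^⇒≤1 irr (suc zero)    _        = s≤s z≤n
SquareFree-^⇒≤1 {P} irr (suc (suc j)) (_ , sf) =
  ⊥-elim (sf P (Irreducible⇒size≥2 irr) (subst ((P *ₚ P) ∣_) (*-assoc P P (P ^ₚ j)) (A∣A*B (P *ₚ P) (P ^ₚ j))))

SquareFree-irreducible : ∀ {P} → Irreducible P → SquareFree P
SquareFree-irreducible {P} irr = Irreducible⇒≢𝟎 irr , λ Q 2≤Q QQ∣P → case Irreducible-divisor irr QQ∣P of λ
  { (inj₁ QQ≡𝟏) → size≥2⇒≢𝟏 2≤Q (∣𝟏⇒≡𝟏 (subst (Q ∣_) QQ≡𝟏 (A∣A*B Q Q)))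
  ; (inj₂ QQ≡P) → [ size≥2⇒≢𝟏 2≤Q , size≥2⇒≢𝟏 2≤Q ]′ (proj₂ (proj₂ irr) Q Q QQ≡P) }

T-⇒ᵇ : ∀ {a b} → T (a ⇒ᵇ b) → T a → T b
T-⇒ᵇ {true} t _ = t

⇒ᵇ-intro : ∀ {a b} → (T a → T b) → T (a ⇒ᵇ b)
⇒ᵇ-intro {false} _ = _
⇒ᵇ-intro {true}  f = f _

T-not⇒¬T : ∀ {b} → T (not b) → ¬ T b
T-not⇒¬T {false} _ ()

¬T⇒T-not : ∀ {b} → ¬ T b → T (not b)
¬T⇒T-not {false} _ = _
¬T⇒T-not {true}  f = f _

coprime?-sound : ∀ {D E} → D ≢ 𝟎 → T (coprime? D E) → Coprime D E
coprime?-sound {D} {E} nD t C C∣D C∣E = ==-sound C 𝟏 (T-⇒ᵇ (lookup (all⁺ _ _ t) C∈)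
  (Equivalence.from T-∧ (divides?-complete C D C∣D , divides?-complete C E C∣E)))
  where C∈ = ∈-allPolys (size D ⊔ size E) (ℕ.≤-trans (∣⇒size≤ nD C∣D) (ℕ.m≤m⊔n _ _))

coprime?-complete : ∀ {D E} → Coprime D E → T (coprime? D E)
coprime?-complete {D} {E} cp =
  all⁻ (λ C → (divides? C D ∧ divides? C E) ⇒ᵇ (C == 𝟏)) {xs = allPolys (size D ⊔ size E)} (tabulate λ {C} _ →
    ⇒ᵇ-intro λ t → let (t₁ , t₂) = Equivalence.to T-∧ t in
      subst (λ X → T (C == X)) (cp C (divides?-sound C D t₁) (divides?-sound C E t₂)) (==-refl C))

squarefree?-sound : ∀ {E} → T (squarefree? E) → SquareFree E
squarefree?-sound {𝟎}     ()
squarefree?-sound {pos e} t = (λ ()) , λ Q 2≤Q QQ∣E →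
  T-not⇒¬T (T-⇒ᵇ (lookup (all⁺ _ _ t) (Q∈ Q 2≤Q QQ∣E)) (ℕ.≤⇒≤ᵇ 2≤Q))
           (divides?-complete (Q *ₚ Q) (pos e) QQ∣E)
  where
  nQ = λ Q 2≤Q → size≥2⇒≢𝟎 {Q} 2≤Q
  Q∈ : ∀ Q → 2 ≤ size Q → (Q *ₚ Q) ∣ pos e → Q ∈ allPolys (sizePos e)
  Q∈ Q 2≤Q QQ∣E = ∈-allPolys _ (ℕ.≤-trans (size-*-≥ʳ (nQ Q 2≤Q) (nQ Q 2≤Q)) (∣⇒size≤ (λ ()) QQ∣E))

squarefree?-complete : ∀ {E} → SquareFree E → T (squarefree? E)
squarefree?-complete {𝟎}     (nz , _) = nz refl
squarefree?-complete {pos e} (_ , sf) =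
  all⁻ (λ P → (2 ≤ᵇ size P) ⇒ᵇ not (divides? (P *ₚ P) (pos e))) {xs = allPolys (sizePos e)} (tabulate λ {Q} _ →
    ⇒ᵇ-intro λ 2≤ᵇQ → ¬T⇒T-not (sf Q (ℕ.≤ᵇ⇒≤ 2 (size Q) 2≤ᵇQ) ∘ divides?-sound (Q *ₚ Q) (pos e)))

∑ : {X : Set} → (X → Poly) → List X → Poly
∑ f xs = sumP (map f xs)

module _ {X : Set} where

  ∑-++ : (f : X → Poly) (xs ys : List X) → ∑ f (xs ++ ys) ≡ ∑ f xs +ₚ ∑ f ys
  ∑-++ f []       ys = refl
  ∑-++ f (x ∷ xs) ys = trans (cong (f x +ₚ_) (∑-++ f xs ys)) (sym (+-assoc (f x) _ _))

  ∑-cong : {f g : X → Poly} (xs : List X) → (∀ {x} → x ∈ xs → f x ≡ g x) → ∑ f xs ≡ ∑ g xs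
  ∑-cong []       _  = refl
  ∑-cong (x ∷ xs) eq = cong₂ _+ₚ_ (eq (here refl)) (∑-cong xs (eq ∘ there))

  ∑-zero : (f : X → Poly) (xs : List X) → (∀ {x} → x ∈ xs → f x ≡ 𝟎) → ∑ f xs ≡ 𝟎
  ∑-zero f []       _  = refl
  ∑-zero f (x ∷ xs) eq = cong₂ _+ₚ_ (eq (here refl)) (∑-zero f xs (eq ∘ there))

  *-distribˡ-∑ : (c : Poly) (f : X → Poly) (xs : List X) → c *ₚ ∑ f xs ≡ ∑ (λ x → c *ₚ f x) xs
  *-distribˡ-∑ c f []       = *-zeroʳ c
  *-distribˡ-∑ c f (x ∷ xs) = trans (*-distribˡ-+ c (f x) _) (cong (c *ₚ f x +ₚ_) (*-distribˡ-∑ c f xs))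

  ∑-filterᵇ : (p : X → Bool) (f : X → Poly) (xs : List X) →
              ∑ f (filterᵇ p xs) ≡ ∑ (λ x → if p x then f x else 𝟎) xs
  ∑-filterᵇ p f []       = refl
  ∑-filterᵇ p f (x ∷ xs) with p x
  ... | true  = cong (f x +ₚ_) (∑-filterᵇ p f xs)
  ... | false = ∑-filterᵇ p f xs

  ∑-↭ : (f : X → Poly) {xs ys : List X} → xs ↭ ys → ∑ f xs ≡ ∑ f ys
  ∑-↭ f p = foldr-commMonoid (setoid Poly) +-isCommutativeMonoid (↭⇒↭ₛ (map⁺ f p))

  ∑-unique-⇔ : (f : X → Poly) {xs ys : List X} → Unique xs → Unique ys →
             (∀ {z} → z ∈ xs → z ∈ ys) → (∀ {z} → z ∈ ys → z ∈ xs) → ∑ f xs ≡ ∑ f ys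
  ∑-unique-⇔ f uxs uys xs⊆ys ys⊆xs = ∑-↭ f (∼bag⇒↭ (unique∧set⇒bag uxs uys (mk⇔ xs⊆ys ys⊆xs)))

  Unique-map⁺ : {Y : Set} (g : X → Y) {xs : List X} → (∀ {a b} → a ∈ xs → b ∈ xs → g a ≡ g b → a ≡ b) →
                Unique xs → Unique (map g xs)
  Unique-map⁺ g injective []             = []
  Unique-map⁺ g injective (x∉xs ∷ uxs) =
    All-map⁺ (tabulate λ b∈ ga≡gb → lookup x∉xs b∈ (injective (here refl) (there b∈) ga≡gb))
    ∷ Unique-map⁺ g (λ a∈ b∈ → injective (there a∈) (there b∈)) uxs

∑-cartesianProduct : {X Y : Set} (f : X → Poly) (g : Y → Poly) (xs : List X) (ys : List Y) →
  ∑ f xs *ₚ ∑ g ys ≡ ∑ (λ xy → f (proj₁ xy) *ₚ g (proj₂ xy)) (cartesianProduct xs ys)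
∑-cartesianProduct f g []       ys = refl
∑-cartesianProduct f g (x ∷ xs) ys = begin
  (f x +ₚ ∑ f xs) *ₚ ∑ g ys
    ≡⟨ *-distribʳ-+ (f x) _ _ ⟩
  f x *ₚ ∑ g ys +ₚ ∑ f xs *ₚ ∑ g ys
    ≡⟨ cong₂ _+ₚ_ (trans (*-distribˡ-∑ (f x) g ys) (cong sumP (map-∘ {g = h} {f = x ,_} ys)))
                  (∑-cartesianProduct f g xs ys) ⟩
  ∑ h (map (x ,_) ys) +ₚ ∑ h (cartesianProduct xs ys)
    ≡⟨ ∑-++ h (map (x ,_) ys) _ ⟨
  ∑ h (map (x ,_) ys ++ cartesianProduct xs ys)
    ∎
  where h = λ xy → f (proj₁ xy) *ₚ g (proj₂ xy)

-- Sums over factorisations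

factorPairs-unique : ∀ A → Unique (factorPairs A)
factorPairs-unique A =
  Unique.filter⁺ _ (Unique.cartesianProduct⁺ (allPolys-unique (size A)) (allPolys-unique (size A)))

∈-factorPairs⁻ : ∀ {A D E} → (D , E) ∈ factorPairs A → D *ₚ E ≡ A
∈-factorPairs⁻ {A} m = ==-sound _ _
  (proj₂ (∈-filter⁻ (T? ∘ λ de → (proj₁ de *ₚ proj₂ de) == A)
                    {xs = cartesianProduct (allPolys (size A)) (allPolys (size A))} m))

∈-factorPairs⁺ : ∀ {A D E} → A ≢ 𝟎 → D *ₚ E ≡ A → (D , E) ∈ factorPairs A
∈-factorPairs⁺ {A} {D} {E} nA eq = ∈-filter⁺ (T? ∘ λ de → (proj₁ de *ₚ proj₂ de) == A)
  (∈-cartesianProduct⁺ (∈-allPolys (size A) (∣⇒size≤ nA (*≡⇒∣ˡ {D} {E} eq)))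
                       (∈-allPolys (size A) (∣⇒size≤ nA (*≡⇒∣ʳ {D} {E} eq))))
  (subst (λ X → T (X == A)) (sym eq) (==-refl A))

factorSum : (Poly × Poly → Poly) → Poly → Poly
factorSum F A = ∑ F (factorPairs A)

Multiplicative : (Poly → Poly) → Set
Multiplicative f = ∀ A B → A ≢ 𝟎 → B ≢ 𝟎 → Coprime A B → f (A *ₚ B) ≡ f A *ₚ f B

MultiplicativeKernel : (Poly × Poly → Poly) → Set
MultiplicativeKernel F = ∀ {A B} → A ≢ 𝟎 → B ≢ 𝟎 → Coprime A B → ∀ {D₁ E₁ D₂ E₂} →
  D₁ *ₚ E₁ ≡ A → D₂ *ₚ E₂ ≡ B → F (D₁ *ₚ D₂ , E₁ *ₚ E₂) ≡ F (D₁ , E₁) *ₚ F (D₂ , E₂)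

Multiplicative-resp-≗ : ∀ {f g} → (∀ A → f A ≡ g A) → Multiplicative g → Multiplicative f
Multiplicative-resp-≗ {f} {g} f≗g g-mult A B nA nB cp = begin
  f (A *ₚ B)      ≡⟨ f≗g (A *ₚ B) ⟩
  g (A *ₚ B)      ≡⟨ g-mult A B nA nB cp ⟩
  g A *ₚ g B      ≡⟨ cong₂ _*ₚ_ (f≗g A) (f≗g B) ⟨
  f A *ₚ f B      ∎

multiplyPairs : (Poly × Poly) × (Poly × Poly) → Poly × Poly
multiplyPairs ((D₁ , E₁) , (D₂ , E₂)) = D₁ *ₚ D₂ , E₁ *ₚ E₂

-- For coprime A and B, multiplyPairs is a bijection from pairs of factorisations
-- of A and of B onto the factorisations of A·B.
module _ {A B : Poly} (nA : A ≢ 𝟎) (nB : B ≢ 𝟎) (cp : Coprime A B) where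

  private
    pairs = cartesianProduct (factorPairs A) (factorPairs B)
    nAB = *-≢𝟎 nA nB

  ∈-factorPairs²⁻ : ∀ {D₁ E₁ D₂ E₂} → ((D₁ , E₁) , (D₂ , E₂)) ∈ pairs → D₁ *ₚ E₁ ≡ A × D₂ *ₚ E₂ ≡ B
  ∈-factorPairs²⁻ m = let (m₁ , m₂) = ∈-cartesianProduct⁻ (factorPairs A) (factorPairs B) m
                      in ∈-factorPairs⁻ m₁ , ∈-factorPairs⁻ m₂

  multiplyPairs-sound : ∀ {z} → z ∈ map multiplyPairs pairs → z ∈ factorPairs (A *ₚ B)
  multiplyPairs-sound m with ∈-map⁻ multiplyPairs m
  ... | ((D₁ , E₁) , (D₂ , E₂)) , m' , refl = let (e₁ , e₂) = ∈-factorPairs²⁻ m' in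
    ∈-factorPairs⁺ nAB (trans (*-Properties.interchange D₁ D₂ E₁ E₂) (cong₂ _*ₚ_ e₁ e₂))

  multiplyPairs-complete : ∀ {z} → z ∈ factorPairs (A *ₚ B) → z ∈ map multiplyPairs pairs
  multiplyPairs-complete {D , E} m with divisor-split cp nAB (*≡⇒∣ˡ {D} {E} (∈-factorPairs⁻ m))
  ... | D₁ , D₂ , (E₁ , e₁) , (E₂ , e₂) , D₁D₂≡D =
    subst (_∈ map multiplyPairs pairs) (cong₂ _,_ D₁D₂≡D E₁E₂≡E)
      (∈-map⁺ multiplyPairs {x = (D₁ , E₁) , (D₂ , E₂)}
              (∈-cartesianProduct⁺ (∈-factorPairs⁺ nA f₁) (∈-factorPairs⁺ nB f₂)))
    where
    f₁ = trans (*-comm D₁ E₁) e₁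
    f₂ = trans (*-comm D₂ E₂) e₂
    E₁E₂≡E : E₁ *ₚ E₂ ≡ E
    E₁E₂≡E = *-cancelˡ (∣≢𝟎⇒≢𝟎 nAB (*≡⇒∣ˡ {D} {E} (∈-factorPairs⁻ m))) (begin
      D *ₚ (E₁ *ₚ E₂)             ≡⟨ cong (_*ₚ (E₁ *ₚ E₂)) D₁D₂≡D ⟨
      (D₁ *ₚ D₂) *ₚ (E₁ *ₚ E₂)    ≡⟨ *-Properties.interchange D₁ D₂ E₁ E₂ ⟩
      (D₁ *ₚ E₁) *ₚ (D₂ *ₚ E₂)    ≡⟨ cong₂ _*ₚ_ f₁ f₂ ⟩
      A *ₚ B                      ≡⟨ ∈-factorPairs⁻ m ⟨
      D *ₚ E                      ∎)

  multiplyPairs-injective : ∀ {a b} → a ∈ pairs → b ∈ pairs → multiplyPairs a ≡ multiplyPairs b → a ≡ b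
  multiplyPairs-injective {(D₁ , E₁) , (D₂ , E₂)} {(D₁' , E₁') , (D₂' , E₂')} ma mb eq
    with ∈-factorPairs²⁻ ma | ∈-factorPairs²⁻ mb
  ... | a₁ , a₂ | b₁ , b₂ = cong₂ _,_ (cong₂ _,_ D₁≡D₁' E₁≡E₁') (cong₂ _,_ D₂≡D₂' E₂≡E₂')
    where
    D≡ = cong proj₁ eq
    nD₁ = ∣≢𝟎⇒≢𝟎 nA (*≡⇒∣ˡ {D₁} {E₁} a₁)
    nD₂ = ∣≢𝟎⇒≢𝟎 nB (*≡⇒∣ˡ {D₂} {E₂} a₂)
    D₁≡D₁' : D₁ ≡ D₁'
    D₁≡D₁' = ∣-antisym (∣≢𝟎⇒≢𝟎 nA (*≡⇒∣ˡ {D₁'} {E₁'} b₁))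
      (coprime-divisor (Coprime-∣ cp (*≡⇒∣ˡ {D₁} {E₁} a₁) (*≡⇒∣ˡ {D₂'} {E₂'} b₂))
                       (subst (D₁ ∣_) D≡ (A∣A*B D₁ D₂)))
      (coprime-divisor (Coprime-∣ cp (*≡⇒∣ˡ {D₁'} {E₁'} b₁) (*≡⇒∣ˡ {D₂} {E₂} a₂))
                       (subst (D₁' ∣_) (sym D≡) (A∣A*B D₁' D₂')))
    D₂≡D₂' = *-cancelˡ nD₁ (trans D≡ (cong (_*ₚ D₂') (sym D₁≡D₁')))
    E₁≡E₁' = *-cancelˡ nD₁ (trans a₁ (trans (sym b₁) (cong (_*ₚ E₁') (sym D₁≡D₁'))))
    E₂≡E₂' = *-cancelˡ nD₂ (trans a₂ (trans (sym b₂) (cong (_*ₚ E₂') (sym D₂≡D₂'))))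

factorSum-multiplicative : ∀ F → MultiplicativeKernel F → Multiplicative (factorSum F)
factorSum-multiplicative F kernel A B nA nB cp = sym (begin
  factorSum F A *ₚ factorSum F B                 ≡⟨ ∑-cartesianProduct F F (factorPairs A) (factorPairs B) ⟩
  ∑ (λ xy → F (proj₁ xy) *ₚ F (proj₂ xy)) pairs  ≡⟨ ∑-cong pairs kernel-pairs ⟩
  ∑ (F ∘ multiplyPairs) pairs                    ≡⟨ cong sumP (map-∘ pairs) ⟩
  ∑ F (map multiplyPairs pairs)                  ≡⟨ ∑-unique-⇔ F unique (factorPairs-unique (A *ₚ B))
                                                      (multiplyPairs-sound nA nB cp) (multiplyPairs-complete nA nB cp) ⟩
  factorSum F (A *ₚ B)                           ∎)
  where
  pairs = cartesianProduct (factorPairs A) (factorPairs B)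
  kernel-pairs : ∀ {x} → x ∈ pairs → F (proj₁ x) *ₚ F (proj₂ x) ≡ F (multiplyPairs x)
  kernel-pairs m = let (e₁ , e₂) = ∈-factorPairs²⁻ nA nB cp m in sym (kernel nA nB cp e₁ e₂)
  unique : Unique (map multiplyPairs pairs)
  unique = Unique-map⁺ multiplyPairs (multiplyPairs-injective nA nB cp)
             (Unique.cartesianProduct⁺ (factorPairs-unique A) (factorPairs-unique B))

if-T : ∀ {b} {x y : Poly} → T b → (if b then x else y) ≡ x
if-T {true} _ = refl

if-¬T : ∀ {b} {x y : Poly} → ¬ T b → (if b then x else y) ≡ y
if-¬T {false} _ = refl
if-¬T {true}  f = ⊥-elim (f _)

if-* : ∀ {p q r : Bool} {x y z : Poly} →
       (T p → T q → T r) → (T r → T p × T q) → (T p → T q → z ≡ x *ₚ y) →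
       (if r then z else 𝟎) ≡ (if p then x else 𝟎) *ₚ (if q then y else 𝟎)
if-* {true}  {true}  {x = x} intro elim value = trans (if-T (intro _ _)) (value _ _)
if-* {true}  {false} {x = x} intro elim value = trans (if-¬T (proj₂ ∘ elim)) (sym (*-zeroʳ x))
if-* {false}                 intro elim value = if-¬T (proj₁ ∘ elim)

unitaryKernel : Poly × Poly → Poly
unitaryKernel de = if coprime? (proj₁ de) (proj₂ de) then proj₁ de else 𝟎

σ*≡factorSum : ∀ A → σ* A ≡ factorSum unitaryKernel A
σ*≡factorSum A = ∑-filterᵇ (λ de → coprime? (proj₁ de) (proj₂ de)) proj₁ (factorPairs A)

unitaryKernel-multiplicative : MultiplicativeKernel unitaryKernel
unitaryKernel-multiplicative {A} {B} nA nB cp {D₁} {E₁} {D₂} {E₂} e₁ e₂ = if-* intro elim (λ _ _ → refl)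
  where
  D₁∣A = *≡⇒∣ˡ {D₁} {E₁} e₁
  D₂∣B = *≡⇒∣ˡ {D₂} {E₂} e₂
  nD₁ = ∣≢𝟎⇒≢𝟎 nA D₁∣A
  nD₂ = ∣≢𝟎⇒≢𝟎 nB D₂∣B
  E₁∣A = *≡⇒∣ʳ {D₁} {E₁} e₁
  E₂∣B = *≡⇒∣ʳ {D₂} {E₂} e₂
  intro : T (coprime? D₁ E₁) → T (coprime? D₂ E₂) → T (coprime? (D₁ *ₚ D₂) (E₁ *ₚ E₂))
  intro t₁ t₂ = coprime?-complete (Coprime-*ʳ
    (Coprime-*ˡ (coprime?-sound nD₁ t₁) (Coprime-∣ (Coprime-sym cp) D₂∣B E₁∣A))
    (Coprime-*ˡ (Coprime-∣ cp D₁∣A E₂∣B) (coprime?-sound nD₂ t₂)))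
  elim : T (coprime? (D₁ *ₚ D₂) (E₁ *ₚ E₂)) → T (coprime? D₁ E₁) × T (coprime? D₂ E₂)
  elim t = coprime?-complete (Coprime-∣ cp' (A∣A*B D₁ D₂) (A∣A*B E₁ E₂)) ,
           coprime?-complete (Coprime-∣ cp' (A∣B*A D₂ D₁) (A∣B*A E₂ E₁))
    where cp' = coprime?-sound (*-≢𝟎 nD₁ nD₂) t

σ*-multiplicative : Multiplicative σ*
σ*-multiplicative = Multiplicative-resp-≗ σ*≡factorSum (factorSum-multiplicative unitaryKernel unitaryKernel-multiplicative)

squarefreeKernel : Poly × Poly → Poly
squarefreeKernel de = if squarefree? (proj₂ de) then σ* (proj₁ de) else 𝟎

sqfreeSum≡factorSum : ∀ A → sqfreeSum A ≡ factorSum squarefreeKernel A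
sqfreeSum≡factorSum A = ∑-filterᵇ (λ de → squarefree? (proj₂ de)) (σ* ∘ proj₁) (factorPairs A)

squarefreeKernel-multiplicative : MultiplicativeKernel squarefreeKernel
squarefreeKernel-multiplicative {A} {B} nA nB cp {D₁} {E₁} {D₂} {E₂} e₁ e₂ = if-* intro elim value
  where
  D₁∣A = *≡⇒∣ˡ {D₁} {E₁} e₁
  D₂∣B = *≡⇒∣ˡ {D₂} {E₂} e₂
  intro : T (squarefree? E₁) → T (squarefree? E₂) → T (squarefree? (E₁ *ₚ E₂))
  intro t₁ t₂ = squarefree?-complete (SquareFree-* (Coprime-∣ cp (*≡⇒∣ʳ {D₁} {E₁} e₁) (*≡⇒∣ʳ {D₂} {E₂} e₂))
                                                   (squarefree?-sound t₁) (squarefree?-sound t₂))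
  elim : T (squarefree? (E₁ *ₚ E₂)) → T (squarefree? E₁) × T (squarefree? E₂)
  elim t = let (sf₁ , sf₂) = SquareFree-*⁻ {E₁} {E₂} (squarefree?-sound {E₁ *ₚ E₂} t)
           in squarefree?-complete sf₁ , squarefree?-complete sf₂
  value : T (squarefree? E₁) → T (squarefree? E₂) → σ* (D₁ *ₚ D₂) ≡ σ* D₁ *ₚ σ* D₂
  value _ _ = σ*-multiplicative D₁ D₂ (∣≢𝟎⇒≢𝟎 nA D₁∣A) (∣≢𝟎⇒≢𝟎 nB D₂∣B) (Coprime-∣ cp D₁∣A D₂∣B)

sqfreeSum-multiplicative : Multiplicative sqfreeSum
sqfreeSum-multiplicative =
  Multiplicative-resp-≗ sqfreeSum≡factorSum (factorSum-multiplicative squarefreeKernel squarefreeKernel-multiplicative)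

-- Prime powers

∑-upTo-suc : (h : ℕ → Poly) (n : ℕ) → ∑ h (upTo (suc n)) ≡ h 0 +ₚ ∑ (h ∘ suc) (upTo n)
∑-upTo-suc h n = cong (λ l → h 0 +ₚ sumP l) (trans (map-applyUpTo suc h n) (sym (map-upTo (h ∘ suc) n)))

∑-upTo-∷ʳ : (h : ℕ → Poly) (n : ℕ) → ∑ h (upTo (suc n)) ≡ ∑ h (upTo n) +ₚ h n
∑-upTo-∷ʳ h n = begin
  ∑ h (upTo (suc n))            ≡⟨ cong (∑ h) (upTo-∷ʳ n) ⟨
  ∑ h (upTo n ++ n ∷ [])        ≡⟨ ∑-++ h (upTo n) (n ∷ []) ⟩
  ∑ h (upTo n) +ₚ (h n +ₚ 𝟎)    ≡⟨ cong (∑ h (upTo n) +ₚ_) (+-identityʳ (h n)) ⟩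
  ∑ h (upTo n) +ₚ h n           ∎

∑-upTo-zero : (h : ℕ → Poly) (n : ℕ) → (∀ {j} → j < n → h j ≡ 𝟎) → ∑ h (upTo n) ≡ 𝟎
∑-upTo-zero h n vanish = ∑-zero h (upTo n) λ j∈ →
  case ∈-applyUpTo⁻ id j∈ of λ { (_ , j<n , refl) → vanish j<n }

module _ {P : Poly} (irr : Irreducible P) where

  private nP = Irreducible⇒≢𝟎 irr

  powerPair : ℕ → ℕ → Poly × Poly
  powerPair n j = P ^ₚ (n ∸ j) , P ^ₚ j

  factorSum-^ : ∀ F n → factorSum F (P ^ₚ n) ≡ ∑ (F ∘ powerPair n) (upTo (suc n))
  factorSum-^ F n = begin
    factorSum F (P ^ₚ n)                     ≡⟨ ∑-unique-⇔ F (factorPairs-unique (P ^ₚ n)) unique complete sound ⟩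
    ∑ F (map (powerPair n) (upTo (suc n)))   ≡⟨ cong sumP (map-∘ {g = F} {f = powerPair n} (upTo (suc n))) ⟨
    ∑ (F ∘ powerPair n) (upTo (suc n))       ∎
    where
    unique : Unique (map (powerPair n) (upTo (suc n)))
    unique = Unique-map⁺ (powerPair n) (λ {i} {j} _ _ eq → ^-injective irr i j (cong proj₂ eq))
                         (Unique.upTo⁺ (suc n))
    complete : ∀ {z} → z ∈ factorPairs (P ^ₚ n) → z ∈ map (powerPair n) (upTo (suc n))
    complete {D , E} m with ∈-factorPairs⁻ m
    ... | DE≡Pⁿ with ∣^⇒≡^ irr n (D , DE≡Pⁿ)
    ...   | j , j≤n , refl = subst (_∈ map (powerPair n) (upTo (suc n))) (cong (_, P ^ₚ j) D≡)
                               (∈-map⁺ (powerPair n) (∈-applyUpTo⁺ id (s≤s j≤n)))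
      where
      D≡ : P ^ₚ (n ∸ j) ≡ D
      D≡ = *-cancelʳ (^-≢𝟎 nP j) (begin
        P ^ₚ (n ∸ j) *ₚ P ^ₚ j    ≡⟨ ^-distribˡ-+-* P (n ∸ j) j ⟨
        P ^ₚ (n ∸ j + j)          ≡⟨ cong (P ^ₚ_) (ℕ.m∸n+n≡m j≤n) ⟩
        P ^ₚ n                    ≡⟨ DE≡Pⁿ ⟨
        D *ₚ P ^ₚ j               ∎)
    sound : ∀ {z} → z ∈ map (powerPair n) (upTo (suc n)) → z ∈ factorPairs (P ^ₚ n)
    sound m with ∈-map⁻ (powerPair n) m
    ... | j , j∈ , refl with ∈-applyUpTo⁻ id j∈
    ...   | _ , s≤s j≤n , refl = ∈-factorPairs⁺ (^-≢𝟎 nP n)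
            (trans (sym (^-distribˡ-+-* P (n ∸ j) j)) (cong (P ^ₚ_) (ℕ.m∸n+n≡m j≤n)))

  σ*-^ : ∀ m → σ* (P ^ₚ suc m) ≡ P ^ₚ suc m +ₚ 𝟏
  σ*-^ m = begin
    σ* (P ^ₚ suc m)                                     ≡⟨ σ*≡factorSum (P ^ₚ suc m) ⟩
    factorSum unitaryKernel (P ^ₚ suc m)                ≡⟨ factorSum-^ unitaryKernel (suc m) ⟩
    ∑ h (upTo (suc (suc m)))                            ≡⟨ ∑-upTo-suc h (suc m) ⟩
    h 0 +ₚ ∑ (h ∘ suc) (upTo (suc m))                   ≡⟨ cong (h 0 +ₚ_) (∑-upTo-∷ʳ (h ∘ suc) m) ⟩
    h 0 +ₚ (∑ (h ∘ suc) (upTo m) +ₚ h (suc m))          ≡⟨ cong₂ _+ₚ_ first (cong₂ _+ₚ_ mixed last) ⟩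
    P ^ₚ suc m +ₚ 𝟏                                     ∎
    where
    h = unitaryKernel ∘ powerPair (suc m)
    first : h 0 ≡ P ^ₚ suc m
    first = if-T (coprime?-complete (Coprime-sym (Coprime-𝟏 (P ^ₚ suc m))))
    last : h (suc m) ≡ 𝟏
    last rewrite ℕ.n∸n≡0 m = if-T (coprime?-complete (Coprime-𝟏 (P ^ₚ suc m)))
    mixed : ∑ (h ∘ suc) (upTo m) ≡ 𝟎
    mixed = ∑-upTo-zero (h ∘ suc) m not-unitary
      where
      not-unitary : ∀ {j} → j < m → h (suc j) ≡ 𝟎
      not-unitary {j} j<m rewrite ℕ.+-∸-assoc 1 j<m =
        if-¬T (¬Coprime-^ irr (m ∸ suc j) j ∘ coprime?-sound (^-≢𝟎 nP (suc (m ∸ suc j))))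

  sqfreeSum-^ : ∀ k → sqfreeSum (P ^ₚ suc (suc k)) ≡ P ^ₚ suc (suc k) +ₚ P ^ₚ suc k
  sqfreeSum-^ k = begin
    sqfreeSum (P ^ₚ n)                               ≡⟨ sqfreeSum≡factorSum (P ^ₚ n) ⟩
    factorSum squarefreeKernel (P ^ₚ n)              ≡⟨ factorSum-^ squarefreeKernel n ⟩
    ∑ h (upTo (suc n))                               ≡⟨ ∑-upTo-suc h n ⟩
    h 0 +ₚ ∑ (h ∘ suc) (upTo n)                      ≡⟨ cong (h 0 +ₚ_) (∑-upTo-suc (h ∘ suc) (suc k)) ⟩
    h 0 +ₚ (h 1 +ₚ ∑ (h ∘ suc ∘ suc) (upTo (suc k))) ≡⟨ cong₂ _+ₚ_ (σ*-^ (suc k)) (cong₂ _+ₚ_ h1 higher) ⟩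
    (P ^ₚ n +ₚ 𝟏) +ₚ ((P ^ₚ suc k +ₚ 𝟏) +ₚ 𝟎)        ≡⟨ cong ((P ^ₚ n +ₚ 𝟏) +ₚ_) (+-identityʳ _) ⟩
    (P ^ₚ n +ₚ 𝟏) +ₚ (P ^ₚ suc k +ₚ 𝟏)               ≡⟨ +-Properties.interchange (P ^ₚ n) 𝟏 (P ^ₚ suc k) 𝟏 ⟩
    (P ^ₚ n +ₚ P ^ₚ suc k) +ₚ 𝟎                      ≡⟨ +-identityʳ _ ⟩
    P ^ₚ n +ₚ P ^ₚ suc k                             ∎
    where
    n = suc (suc k)
    h = squarefreeKernel ∘ powerPair n
    h1 : h 1 ≡ P ^ₚ suc k +ₚ 𝟏
    h1 = trans (if-T (squarefree?-complete (subst SquareFree (sym (*-identityʳ P)) (SquareFree-irreducible irr))))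
               (σ*-^ k)
    higher : ∑ (h ∘ suc ∘ suc) (upTo (suc k)) ≡ 𝟎
    higher = ∑-upTo-zero (h ∘ suc ∘ suc) (suc k) λ {j} _ →
      if-¬T (λ t → ℕ.<⇒≱ (s≤s (s≤s z≤n)) (SquareFree-^⇒≤1 irr (suc (suc j)) (squarefree?-sound t)))

-- Splitting off the largest power P^(k+1) of an irreducible factor of S writes
-- S² as the coprime product (P^(k+1))² · T², where T has smaller degree than S.
multiplicative-agree-on-squares : ∀ f g → Multiplicative f → Multiplicative g → f 𝟏 ≡ g 𝟏 →
  (∀ P k → Irreducible P → f (P ^ₚ suc k *ₚ P ^ₚ suc k) ≡ g (P ^ₚ suc k *ₚ P ^ₚ suc k)) →
  ∀ S → S ≢ 𝟎 → f (S *ₚ S) ≡ g (S *ₚ S)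
multiplicative-agree-on-squares f g f-mult g-mult f𝟏≡g𝟏 agree R = go R (<-wellFounded (size R))
  where
  go : ∀ S → Acc _<_ (size S) → S ≢ 𝟎 → f (S *ₚ S) ≡ g (S *ₚ S)
  go S rec nS with S ≟ 𝟏
  ... | yes refl = f𝟏≡g𝟏
  ... | no S≢𝟏 with irreducible-factor S (size≥2 nS S≢𝟏)
  ...   | P , irr , P∣S with ∣⇒maximal-power irr nS P∣S
  go _ (acc rec) nS | no _ | P , irr , _ | k , T , refl , P∤T = begin
    f (S *ₚ S)            ≡⟨ cong f S²≡ ⟩
    f (Q *ₚ (T *ₚ T))     ≡⟨ f-mult Q (T *ₚ T) nQ nT² cp ⟩
    f Q *ₚ f (T *ₚ T)     ≡⟨ cong₂ _*ₚ_ (agree P k irr) (go T (rec T<S) nT) ⟩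
    g Q *ₚ g (T *ₚ T)     ≡⟨ g-mult Q (T *ₚ T) nQ nT² cp ⟨
    g (Q *ₚ (T *ₚ T))     ≡⟨ cong g S²≡ ⟨
    g (S *ₚ S)            ∎
    where
    Pᵏ⁺¹ = P ^ₚ suc k
    S = Pᵏ⁺¹ *ₚ T
    Q = Pᵏ⁺¹ *ₚ Pᵏ⁺¹
    nPᵏ⁺¹ = ^-≢𝟎 (Irreducible⇒≢𝟎 irr) (suc k)
    nT = *-≢𝟎ʳ {Pᵏ⁺¹} {T} nS
    nQ = *-≢𝟎 nPᵏ⁺¹ nPᵏ⁺¹
    nT² = *-≢𝟎 nT nT
    S²≡ : S *ₚ S ≡ Q *ₚ (T *ₚ T)
    S²≡ = *-Properties.interchange Pᵏ⁺¹ T Pᵏ⁺¹ T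
    cp : Coprime Q (T *ₚ T)
    cp = Coprime-*ˡ cp' cp'
      where cp' = ∤⇒Coprime-^ irr ([ P∤T , P∤T ]′ ∘ euclidsLemma irr) (suc k)
    T<S : size T < size S
    T<S = subst (λ X → size T < size X) (*-comm T Pᵏ⁺¹)
            (size-*->ˡ nT (ℕ.≤-trans (Irreducible⇒size≥2 irr) (∣⇒size≤ nPᵏ⁺¹ (A∣A*B P (P ^ₚ k)))))

^-square : ∀ P k → P ^ₚ suc k *ₚ P ^ₚ suc k ≡ P ^ₚ suc (suc (k + k))
^-square P k = trans (sym (^-distribˡ-+-* P (suc k) (suc k))) (cong (λ e → P ^ₚ suc e) (ℕ.+-suc k k))

corollary3p18 : (φ : Poly → Poly)
    → φ 𝟏 ≡ 𝟏
    → (∀ A B → A ≢ 𝟎 → B ≢ 𝟎 → Coprime A B → φ (A *ₚ B) ≡ φ A *ₚ φ B)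
    → (∀ P (r : ℕ) → Irreducible P → φ (P ^ₚ suc r) ≡ P ^ₚ suc r +ₚ P ^ₚ r)
    → ∀ A → A ≢ 𝟎 → IsSquare A
    → φ A ≡ sqfreeSum A
-- φ𝟏 serves as the agreement at 𝟏 because sqfreeSum 𝟏 evaluates to 𝟏.
corollary3p18 φ φ𝟏 φ-mult φ-^ _ nA (S , refl) =
  multiplicative-agree-on-squares φ sqfreeSum φ-mult sqfreeSum-multiplicative φ𝟏 agree S (*-≢𝟎ˡ {S} {S} nA)
  where
  agree : ∀ P k → Irreducible P → φ (P ^ₚ suc k *ₚ P ^ₚ suc k) ≡ sqfreeSum (P ^ₚ suc k *ₚ P ^ₚ suc k)
  agree P k irr rewrite ^-square P k = trans (φ-^ P (suc (k + k)) irr) (sym (sqfreeSum-^ irr (k + k)))
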